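{- Let $n\ge 6$ be an integer and let $\Delta_n$ be the graph defined in the context. Then the metric dimension of $\Delta_n$ is $3$, i.e. $\dim(\Delta_n)=3$.
   Context: All indices are taken modulo $n$ (so $p_{n+1}=p_1$, etc.). The heptagonal circular ladder $\Gamma_n$ is the graph with vertex set $\{p_t,q_t,r_t,s_t : 1\le t\le n\}$ ($4n$ vertices) and edge set $\{p_tp_{t+1},\ p_tq_t,\ q_tr_t,\ r_ts_t,\ s_tr_{t+1} : 1\le t\le n\}$ ($5n$ edges); thus the $p_t$ form an $n$-cycle, the $r_t,s_t$ form a $2n$-cycle $r_1s_1r_2s_2\cdots r_ns_n$, and the faces $p_tp_{t+1}q_{t+1}r_{t+1}s_tr_tq_t$ are heptagons. The graph $\Delta_n$ has the same vertex set as $\Gamma_n$ and edge set $E(\Gamma_n)\cup\{r_tq_{t+1}:1\le t\le n\}$ ($6n$ edges). For a connected graph $G$ with distance $d$, a set $Y\subseteq V(G)$ is a resolving set if for every two distinct vertices $u,v$ there is $y\in Y$ with $d(y,u)\ne d(y,v)$; the metric dimension $\dim(G)$ is the minimum cardinality of a resolving set. -}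

module Defs where

open import Data.Nat using (ℕ; zero; suc; _≤_)
open import Data.Nat.DivMod using (_%_; m%n<n)
open import Data.Fin using (Fin; toℕ; fromℕ<)
open import Data.Product using (_×_; ∃; ∃-syntax)
open import Data.Sum using (_⊎_)
open import Data.List using (List; length)
open import Data.List.Membership.Propositional using (_∈_)
open import Data.List.Relation.Unary.Unique.Propositional using (Unique)
open import Relation.Binary.PropositionalEquality using (_≡_; _≢_)

next : ∀ {n} → Fin n → Fin n
next {suc m} i = fromℕ< (m%n<n (suc (toℕ i)) (suc m))

data Kind : Set where
  P Q R S : Kind

Vertex : ℕ → Set
Vertex n = Kind × Fin n

open import Data.Product using (_,_)

-- the 6n (directed representatives of) edges of Δ_n
data ΔArc {n : ℕ} : Vertex n → Vertex n → Set where
  pp : ∀ t → ΔArc (P , t) (P , next t)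
  pq : ∀ t → ΔArc (P , t) (Q , t)
  qr : ∀ t → ΔArc (Q , t) (R , t)
  rs : ∀ t → ΔArc (R , t) (S , t)
  sr : ∀ t → ΔArc (S , t) (R , next t)
  rq : ∀ t → ΔArc (R , t) (Q , next t)

ΔAdj : ∀ {n} → Vertex n → Vertex n → Set
ΔAdj u v = ΔArc u v ⊎ ΔArc v u

module _ {V : Set} (Adj : V → V → Set) where

  data Walk : V → V → ℕ → Set where
    here : ∀ {u} → Walk u u 0
    step : ∀ {u w v k} → Adj u w → Walk w v k → Walk u v (suc k)

  Dist : V → V → ℕ → Set
  Dist u v d = Walk u v d × (∀ k → Walk u v k → d ≤ k)

  Resolving : List V → Set
  Resolving Y = ∀ u v → u ≢ v →
    ∃[ y ] (y ∈ Y × ∃[ a ] ∃[ b ] (Dist y u a × Dist y v b × a ≢ b))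

  MetricDim : ℕ → Set
  MetricDim d =
    (∃[ Y ] (Unique Y × Resolving Y × length Y ≡ d)) ×
    (∀ Y → Unique Y → Resolving Y → d ≤ length Y)

-- Upper bound: p₀, p₁ and pₘ with m = ⌊n/2⌋ resolve Δₙ. The distance from p_j to the vertex of
-- kind k at offset δ from j is layer k + min(δ, n − shortcut k − δ). Whether the distance to p₀ is one
-- more than, one less than, or equal to the distance to p₁ tells on which half of the cycle a vertex
-- lies (or that it sits at one of a few exceptional positions); within each case the distances to p₀
-- and pₘ determine its kind and position, so an explicit decoder recovers every vertex from its three
-- distances.
-- Lower bound: no two vertices resolve Δₙ. If y₁ is not an s-vertex, it has 2 + 2e vertices at some
-- distance e (the four neighbours of an r-vertex; six vertices at distance 2 from a p- or q-vertex);
-- their distances to y₂ would have to be pairwise distinct, yet they lie in a window of width 2e. For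
-- two s-vertices, the distances from the second one to the vertices around the first one are
-- constrained by the edges among them until no value is left for the distance to s₀ or s₂.

module Submission where

open import Defs
open import Data.Nat
open import Data.Nat.Properties
open import Data.Nat.DivMod
open import Algebra.Properties.CommutativeSemigroup +-commutativeSemigroup using (xy∙z≈xz∙y)
open import Data.Fin using (Fin; toℕ; fromℕ<) renaming (zero to fzero; suc to fsuc)
open import Data.Fin.Properties using (toℕ-fromℕ<; toℕ-injective; toℕ<n; pigeonhole) renaming (_≟_ to _≟ᶠ_)
open import Data.Product
open import Data.Sum
open import Data.Empty
open import Data.List using (List; []; _∷_; length)
open import Data.List.Membership.Propositional using (_∈_; find)
open import Data.List.Relation.Unary.All as All using (All; all?; lookup)
open import Data.List.Relation.Unary.All.Properties using (¬All⇒Any¬)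
open import Data.List.Relation.Unary.Any using (here; there)
import Data.List.Relation.Unary.Unique.Propositional as Unique
open import Data.Fin.Patterns using (0F; 1F; 2F; 3F; 4F; 5F)
open import Function using (_∘_)
open import Data.Nat.Tactic.RingSolver using (solve)
open import Relation.Nullary
open import Relation.Binary.PropositionalEquality
open import Relation.Binary.Definitions using (tri<; tri≈; tri>)

m+k≡n⇒m≤n : ∀ {m n} k → m + k ≡ n → m ≤ n
m+k≡n⇒m≤n {m} k refl = m≤m+n m k

minimumᶠ : ∀ {k} → (Fin (suc k) → ℕ) → ℕ
minimumᶠ {zero} f = f fzero
minimumᶠ {suc k} f = f fzero ⊓ minimumᶠ (f ∘ fsuc)

minimumᶠ-≤ : ∀ {k} (f : Fin (suc k) → ℕ) i → minimumᶠ f ≤ f i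
minimumᶠ-≤ {zero} f fzero = ≤-refl
minimumᶠ-≤ {suc k} f fzero = m⊓n≤m _ _
minimumᶠ-≤ {suc k} f (fsuc i) = ≤-trans (m⊓n≤n _ _) (minimumᶠ-≤ (f ∘ fsuc) i)

minimumᶠ-greatest : ∀ {k} (f : Fin (suc k) → ℕ) {b} → (∀ i → b ≤ f i) → b ≤ minimumᶠ f
minimumᶠ-greatest {zero} f b≤f = b≤f fzero
minimumᶠ-greatest {suc k} f b≤f = ⊓-glb (b≤f fzero) (minimumᶠ-greatest (f ∘ fsuc) (b≤f ∘ fsuc))

minimumᶠ-within : ∀ D (d : Fin (2 + D) → ℕ) → (∀ i j → d j ≤ d i + D) →
                  ∀ i → d i ∸ minimumᶠ d < suc D
minimumᶠ-within D d narrow i = s≤s (m≤n+o⇒m∸n≤o (d i) (minimumᶠ d) (begin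
  d i                       ≤⟨ m≤n+m∸n (d i) D ⟩
  D + (d i ∸ D)             ≤⟨ +-monoʳ-≤ D (minimumᶠ-greatest d (λ j → m≤n+o⇒m∸n≤o (d i) D (d[i]≤D+d[j] j))) ⟩
  D + minimumᶠ d            ≡⟨ +-comm D _ ⟩
  minimumᶠ d + D            ∎))
  where
  open ≤-Reasoning
  d[i]≤D+d[j] : ∀ j → d i ≤ D + d j
  d[i]≤D+d[j] j = ≤-trans (narrow j i) (≤-reflexive (+-comm (d j) D))

narrow-family-collides : ∀ D (d : Fin (2 + D) → ℕ) → (∀ i j → d j ≤ d i + D) →
                         ∃₂ λ i j → i ≢ j × d i ≡ d j
narrow-family-collides D d narrow
  with i , j , i<j , same ← pigeonhole ≤-refl (λ i → fromℕ< (minimumᶠ-within D d narrow i)) =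
  i , j , (λ i≡j → <-irrefl (cong toℕ i≡j) i<j) ,
  ∸-cancelʳ-≡ (minimumᶠ-≤ d i) (minimumᶠ-≤ d j) (begin
    d i ∸ minimumᶠ d ≡⟨ toℕ-fromℕ< _ ⟨
    toℕ (fromℕ< _)   ≡⟨ cong toℕ same ⟩
    toℕ (fromℕ< _)   ≡⟨ toℕ-fromℕ< _ ⟩
    d j ∸ minimumᶠ d ∎)
  where open ≡-Reasoning

module WalkProperties {V : Set} (Adj : V → V → Set)
                      (Adj-sym : ∀ {u v} → Adj u v → Adj v u) where

  _++ʷ_ : ∀ {u v w a b} → Walk Adj u v a → Walk Adj v w b → Walk Adj u w (a + b)
  here ++ʷ q = q
  step e p ++ʷ q = step e (p ++ʷ q)

  snocʷ : ∀ {u v w a} → Walk Adj u v a → Adj v w → Walk Adj u w (suc a)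
  snocʷ here e = step e here
  snocʷ (step e′ p) e = step e′ (snocʷ p e)

  reverseʷ : ∀ {u v a} → Walk Adj u v a → Walk Adj v u a
  reverseʷ here = here
  reverseʷ (step e p) = snocʷ (reverseʷ p) (Adj-sym e)

  unsnocʷ : ∀ {u v a} → Walk Adj u v (suc a) → ∃[ w ] (Walk Adj u w a × Adj w v)
  unsnocʷ (step e here) = _ , here , e
  unsnocʷ (step e (step e′ p)) with unsnocʷ (step e′ p)
  ... | w , q , e″ = w , step e q , e″

  Walk-0⇒≡ : ∀ {u v} → Walk Adj u v 0 → u ≡ v
  Walk-0⇒≡ here = refl

  Dist-functional : ∀ {u v a b} → Dist Adj u v a → Dist Adj u v b → a ≡ b
  Dist-functional (wa , ma) (wb , mb) = ≤-antisym (ma _ wb) (mb _ wa)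

  Dist-triangle : ∀ {y u v a b k} → Dist Adj y u a → Walk Adj u v k → Dist Adj y v b → b ≤ a + k
  Dist-triangle (wa , _) p (_ , mb) = mb _ (wa ++ʷ p)

  Dist-adjacent : ∀ {y u v a b} → Dist Adj y u a → Adj u v → Dist Adj y v b → b ≤ suc a
  Dist-adjacent {a = a} {b} da e db = subst (b ≤_) (+-comm a 1) (Dist-triangle da (step e here) db)

  Walk-lipschitz : (f : V → ℕ) → (∀ {u v} → Adj u v → f v ≤ suc (f u)) →
                   ∀ {u v k} → Walk Adj u v k → f v ≤ f u + k
  Walk-lipschitz f f-lip {u} here = ≤-reflexive (sym (+-identityʳ (f u)))
  Walk-lipschitz f f-lip {u} (step {k = k} e p) = begin
    _             ≤⟨ Walk-lipschitz f f-lip p ⟩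
    _ + k         ≤⟨ +-monoˡ-≤ k (f-lip e) ⟩
    suc (f u) + k ≡⟨ sym (+-suc (f u) k) ⟩
    f u + suc k   ∎
    where open ≤-Reasoning

  Dist-1 : ∀ {y v} → Adj y v → y ≢ v → Dist Adj y v 1
  Dist-1 e y≢v = step e here , λ { zero w → ⊥-elim (y≢v (Walk-0⇒≡ w)) ; (suc k) w → s≤s z≤n }

  Dist-2 : ∀ {y v} → Walk Adj y v 2 → y ≢ v → ¬ Adj y v → Dist Adj y v 2
  Dist-2 w y≢v ¬yv = w , λ
    { zero w → ⊥-elim (y≢v (Walk-0⇒≡ w))
    ; (suc zero) (step e here) → ⊥-elim (¬yv e)
    ; (suc (suc k)) w → s≤s (s≤s z≤n) }

  Dist-3 : ∀ {y v} → Walk Adj y v 3 → y ≢ v → ¬ Adj y v →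
           (∀ {w} → Adj y w → ¬ Adj w v) → Dist Adj y v 3
  Dist-3 w y≢v ¬yv ¬ywv = w , λ
    { zero w → ⊥-elim (y≢v (Walk-0⇒≡ w))
    ; (suc zero) (step e here) → ⊥-elim (¬yv e)
    ; (suc (suc zero)) (step e (step e′ here)) → ⊥-elim (¬ywv e e′)
    ; (suc (suc (suc k))) w → s≤s (s≤s (s≤s z≤n)) }

  Separates : V → V → V → Set
  Separates y u v = ∃[ a ] ∃[ b ] (Dist Adj y u a × Dist Adj y v b × a ≢ b)

  Separates⇒≢ : ∀ {y u v a b} → Separates y u v → Dist Adj y u a → Dist Adj y v b → a ≢ b
  Separates⇒≢ (a′ , b′ , da′ , db′ , a′≢b′) da db a≡b =
    a′≢b′ (trans (Dist-functional da′ da) (trans a≡b (Dist-functional db db′)))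

  Resolving-mono : ∀ {Y Y′} → (∀ {y} → y ∈ Y → y ∈ Y′) → Resolving Adj Y → Resolving Adj Y′
  Resolving-mono Y⊆Y′ res u v u≢v with res u v u≢v
  ... | y , y∈Y , sep = y , Y⊆Y′ y∈Y , sep

  Resolving-swap : ∀ {y₁ y₂} → Resolving Adj (y₁ ∷ y₂ ∷ []) → Resolving Adj (y₂ ∷ y₁ ∷ [])
  Resolving-swap = Resolving-mono λ
    { (here p) → there (here p) ; (there (here p)) → here p ; (there (there ())) }

  Resolving-pair-separates : ∀ {y₁ y₂ u v e} → Resolving Adj (y₁ ∷ y₂ ∷ []) → u ≢ v →
                             Dist Adj y₁ u e → Dist Adj y₁ v e → Separates y₂ u v
  Resolving-pair-separates res u≢v du dv with res _ _ u≢v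
  ... | _ , here refl , sep = ⊥-elim (Separates⇒≢ sep du dv refl)
  ... | _ , there (here refl) , sep = sep
  ... | _ , there (there ()) , _

  Resolving-by-distances : (d : V → V → ℕ) → ∀ Y → All (λ y → ∀ v → Dist Adj y v (d y v)) Y →
                           (∀ u v → All (λ y → d y u ≡ d y v) Y → u ≡ v) → Resolving Adj Y
  Resolving-by-distances d Y dist same⇒≡ u v u≢v with all? (λ y → d y u ≟ d y v) Y
  ... | yes same = ⊥-elim (u≢v (same⇒≡ u v same))
  ... | no ¬same with find (¬All⇒Any¬ (λ y → d y u ≟ d y v) Y ¬same)
  ...   | y , y∈Y , differ = y , y∈Y , d y u , d y v , lookup dist y∈Y u , lookup dist y∈Y v , differ

  ¬Resolving-pair-with-large-sphere :
    ∀ {y₁ y₂} e (ws : Fin (2 + (e + e)) → V) → (∀ i j → i ≢ j → ws i ≢ ws j) →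
    (∀ i → Dist Adj y₁ (ws i) e) → ¬ Resolving Adj (y₁ ∷ y₂ ∷ [])
  ¬Resolving-pair-with-large-sphere {y₁} {y₂} e ws ws-injective on-sphere res =
    contradict (narrow-family-collides (e + e) d narrow)
    where
    separates : ∀ {i j} → i ≢ j → Separates y₂ (ws i) (ws j)
    separates i≢j = Resolving-pair-separates res (ws-injective _ _ i≢j) (on-sphere _) (on-sphere _)
    other : Fin (2 + (e + e)) → Fin (2 + (e + e))
    other fzero = fsuc fzero
    other (fsuc _) = fzero
    ≢other : ∀ i → i ≢ other i
    ≢other fzero ()
    ≢other (fsuc i) ()
    d : Fin (2 + (e + e)) → ℕ
    d i = proj₁ (separates (≢other i))
    d-dist : ∀ i → Dist Adj y₂ (ws i) (d i)
    d-dist i = proj₁ (proj₂ (proj₂ (separates (≢other i))))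
    narrow : ∀ i j → d j ≤ d i + (e + e)
    narrow i j = Dist-triangle (d-dist i) (reverseʷ (proj₁ (on-sphere i)) ++ʷ proj₁ (on-sphere j)) (d-dist j)
    contradict : (∃₂ λ i j → i ≢ j × d i ≡ d j) → ⊥
    contradict (i , j , i≢j , same) = Separates⇒≢ (separates i≢j) (d-dist i) (d-dist j) same

module CyclicIndex (N : ℕ) where

  n : ℕ
  n = suc N

  advance : ℕ → Fin n → Fin n
  advance zero i = i
  advance (suc d) i = next (advance d i)

  offset : Fin n → Fin n → ℕ
  offset j i = (toℕ i + (n ∸ toℕ j)) % n

  %-absorbˡ : ∀ a b → (a % n + b) % n ≡ (a + b) % n
  %-absorbˡ a b = begin
    (a % n + b) % n         ≡⟨ %-distribˡ-+ (a % n) b n ⟩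
    (a % n % n + b % n) % n ≡⟨ cong (λ x → (x + b % n) % n) (m%n%n≡m%n a n) ⟩
    (a % n + b % n) % n     ≡⟨ %-distribˡ-+ a b n ⟨
    (a + b) % n             ∎
    where open ≡-Reasoning

  j+[n∸j]≡n : ∀ (j : Fin n) → toℕ j + (n ∸ toℕ j) ≡ n
  j+[n∸j]≡n j = m+[n∸m]≡n (<⇒≤ (toℕ<n j))

  toℕ-next : ∀ i → toℕ (next i) ≡ suc (toℕ i) % n
  toℕ-next i = toℕ-fromℕ< (m%n<n (suc (toℕ i)) n)

  toℕ-advance : ∀ d i → toℕ (advance d i) ≡ (toℕ i + d) % n
  toℕ-advance zero i = sym (trans (cong (_% n) (+-identityʳ (toℕ i))) (m<n⇒m%n≡m (toℕ<n i)))
  toℕ-advance (suc d) i = begin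
    toℕ (next (advance d i))       ≡⟨ toℕ-next (advance d i) ⟩
    (1 + toℕ (advance d i)) % n    ≡⟨ cong (λ x → (1 + x) % n) (toℕ-advance d i) ⟩
    (1 + (toℕ i + d) % n) % n      ≡⟨ cong (_% n) (+-comm 1 ((toℕ i + d) % n)) ⟩
    ((toℕ i + d) % n + 1) % n      ≡⟨ %-absorbˡ (toℕ i + d) 1 ⟩
    (toℕ i + d + 1) % n            ≡⟨ cong (_% n) (trans (+-assoc (toℕ i) d 1) (cong (toℕ i +_) (+-comm d 1))) ⟩
    (toℕ i + suc d) % n            ∎
    where open ≡-Reasoning

  advance-+ : ∀ a b i → advance (a + b) i ≡ advance a (advance b i)
  advance-+ zero b i = refl
  advance-+ (suc a) b i = cong next (advance-+ a b i)

  advance-period : ∀ i → advance n i ≡ i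
  advance-period i = toℕ-injective (begin
    toℕ (advance n i)  ≡⟨ toℕ-advance n i ⟩
    (toℕ i + n) % n    ≡⟨ [m+n]%n≡m%n (toℕ i) n ⟩
    toℕ i % n          ≡⟨ m<n⇒m%n≡m (toℕ<n i) ⟩
    toℕ i              ∎)
    where open ≡-Reasoning

  advance-back : ∀ a t → a ≤ n → advance a (advance (n ∸ a) t) ≡ t
  advance-back a t a≤n =
    trans (sym (advance-+ a (n ∸ a) t)) (trans (cong (λ d → advance d t) (m+[n∸m]≡n a≤n)) (advance-period t))

  offset<n : ∀ j i → offset j i < n
  offset<n j i = m%n<n (toℕ i + (n ∸ toℕ j)) n

  advance-offset : ∀ j i → advance (offset j i) j ≡ i
  advance-offset j i = toℕ-injective (begin
    toℕ (advance (offset j i) j)               ≡⟨ toℕ-advance (offset j i) j ⟩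
    (toℕ j + (toℕ i + (n ∸ toℕ j)) % n) % n    ≡⟨ cong (_% n) (+-comm (toℕ j) _) ⟩
    ((toℕ i + (n ∸ toℕ j)) % n + toℕ j) % n    ≡⟨ %-absorbˡ (toℕ i + (n ∸ toℕ j)) (toℕ j) ⟩
    (toℕ i + (n ∸ toℕ j) + toℕ j) % n          ≡⟨ cong (_% n) (+-assoc (toℕ i) (n ∸ toℕ j) (toℕ j)) ⟩
    (toℕ i + ((n ∸ toℕ j) + toℕ j)) % n        ≡⟨ cong (λ x → (toℕ i + x) % n) (m∸n+n≡m (<⇒≤ (toℕ<n j))) ⟩
    (toℕ i + n) % n                            ≡⟨ [m+n]%n≡m%n (toℕ i) n ⟩
    toℕ i % n                                  ≡⟨ m<n⇒m%n≡m (toℕ<n i) ⟩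
    toℕ i                                      ∎)
    where open ≡-Reasoning

  offset-advance : ∀ d j → d < n → offset j (advance d j) ≡ d
  offset-advance d j d<n = begin
    (toℕ (advance d j) + (n ∸ toℕ j)) % n   ≡⟨ cong (λ x → (x + (n ∸ toℕ j)) % n) (toℕ-advance d j) ⟩
    ((toℕ j + d) % n + (n ∸ toℕ j)) % n     ≡⟨ %-absorbˡ (toℕ j + d) (n ∸ toℕ j) ⟩
    (toℕ j + d + (n ∸ toℕ j)) % n           ≡⟨ cong (_% n) (xy∙z≈xz∙y (toℕ j) d (n ∸ toℕ j)) ⟩
    (toℕ j + (n ∸ toℕ j) + d) % n           ≡⟨ cong (λ x → (x + d) % n) (j+[n∸j]≡n j) ⟩
    (n + d) % n                             ≡⟨ cong (_% n) (+-comm n d) ⟩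
    (d + n) % n                             ≡⟨ [m+n]%n≡m%n d n ⟩
    d % n                                   ≡⟨ m<n⇒m%n≡m d<n ⟩
    d                                       ∎
    where open ≡-Reasoning

  offset-self : ∀ j → offset j j ≡ 0
  offset-self j = trans (cong (_% n) (j+[n∸j]≡n j)) (n%n≡0 n)

  offset-next : ∀ j i → offset j (next i) ≡ suc (offset j i) % n
  offset-next j i = begin
    (toℕ (next i) + (n ∸ toℕ j)) % n   ≡⟨ cong (λ x → (x + (n ∸ toℕ j)) % n) (toℕ-next i) ⟩
    (suc (toℕ i) % n + (n ∸ toℕ j)) % n ≡⟨ %-absorbˡ (suc (toℕ i)) (n ∸ toℕ j) ⟩
    suc (toℕ i + (n ∸ toℕ j)) % n      ≡⟨ cong (_% n) (+-comm 1 (toℕ i + (n ∸ toℕ j))) ⟩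
    (toℕ i + (n ∸ toℕ j) + 1) % n      ≡⟨ %-absorbˡ (toℕ i + (n ∸ toℕ j)) 1 ⟨
    (offset j i + 1) % n               ≡⟨ cong (_% n) (+-comm (offset j i) 1) ⟩
    suc (offset j i) % n               ∎
    where open ≡-Reasoning

  next-injective : ∀ {i i′} → next i ≡ next i′ → i ≡ i′
  next-injective {i} {i′} eq = begin
    i                   ≡⟨ advance-period i ⟨
    advance (1 + N) i   ≡⟨ cong (λ d → advance d i) (+-comm 1 N) ⟩
    advance (N + 1) i   ≡⟨ advance-+ N 1 i ⟩
    advance N (next i)  ≡⟨ cong (advance N) eq ⟩
    advance N (next i′) ≡⟨ advance-+ N 1 i′ ⟨
    advance (N + 1) i′  ≡⟨ cong (λ d → advance d i′) (+-comm N 1) ⟩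
    advance (1 + N) i′  ≡⟨ advance-period i′ ⟩
    i′                  ∎
    where open ≡-Reasoning

layer : Kind → ℕ
layer P = 0
layer Q = 1
layer R = 2
layer S = 3

-- Walking backwards along the ring, the chords r_t q_{t+1} and s_t r_{t+1} bring an R-vertex
-- one step and an S-vertex two steps closer to the p-cycle.
shortcut : Kind → ℕ
shortcut P = 0
shortcut Q = 0
shortcut R = 1
shortcut S = 2

_≈₁_ : ℕ → ℕ → Set
a ≈₁ b = a ≤ suc b × b ≤ suc a

⊓-+-≤ : ∀ {a b a′ b′} c → a ≤ c + a′ → b ≤ c + b′ → a ⊓ b ≤ c + (a′ ⊓ b′)
⊓-+-≤ c p q = ≤-trans (⊓-mono-≤ p q) (≤-reflexive (sym (+-distribˡ-⊓ c _ _)))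

∸-sucʳ : ∀ a b → a ∸ b ≤ suc (a ∸ suc b)
∸-sucʳ zero zero = z≤n
∸-sucʳ zero (suc b) = z≤n
∸-sucʳ (suc a) zero = s≤s ≤-refl
∸-sucʳ (suc a) (suc b) = ∸-sucʳ a b

∸-sucˡ : ∀ a b → suc a ∸ b ≤ suc (a ∸ b)
∸-sucˡ a zero = ≤-refl
∸-sucˡ zero (suc zero) = z≤n
∸-sucˡ zero (suc (suc b)) = z≤n
∸-sucˡ (suc a) (suc b) = ∸-sucˡ a b

∸-pred : ∀ a b → a ∸ b ≤ suc (a ∸ 1 ∸ b)
∸-pred zero zero = z≤n
∸-pred zero (suc b) = z≤n
∸-pred (suc a) b = ∸-sucˡ a b

module PDistance (N : ℕ) where
  open CyclicIndex N public
  open WalkProperties (ΔAdj {n}) [ inj₂ , inj₁ ]′ public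

  ringDist : ℕ → ℕ → ℕ → ℕ
  ringDist ℓ w δ = ℓ + (δ ⊓ ((n ∸ w) ∸ δ))

  -- The vertex of kind k at offset δ from p_j is reached either by δ steps forward along the
  -- p-cycle followed by layer k steps down, or by going backwards, where the chords save shortcut k.
  pDist : Kind → ℕ → ℕ
  pDist k = ringDist (layer k) (shortcut k)

  pDist-QR : ∀ δ → pDist R δ ≈₁ pDist Q δ
  pDist-QR δ = s≤s (s≤s (⊓-monoʳ-≤ δ (∸-monoˡ-≤ δ (m∸n≤m n 1)))) ,
               s≤s (≤-trans (⊓-+-≤ 1 (n≤1+n δ) (∸-pred n δ)) (n≤1+n _))

  pDist-RS : ∀ δ → pDist S δ ≈₁ pDist R δ
  pDist-RS δ = s≤s (s≤s (s≤s (⊓-monoʳ-≤ δ (∸-monoˡ-≤ δ (∸-monoʳ-≤ n (s≤s (z≤n {1}))))))) ,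
               s≤s (s≤s (≤-trans (⊓-+-≤ 1 (n≤1+n δ) (∸-pred N δ)) (n≤1+n _)))

  pDist-PP : ∀ δ → pDist P (suc δ) ≈₁ pDist P δ
  pDist-PP δ = ⊓-+-≤ 1 ≤-refl (≤-trans (∸-monoʳ-≤ n (n≤1+n δ)) (n≤1+n _)) ,
               ⊓-+-≤ 1 (≤-trans (n≤1+n δ) (n≤1+n (suc δ))) (∸-sucʳ n δ)

  pDist-SR : ∀ δ → pDist R (suc δ) ≈₁ pDist S δ
  pDist-SR δ = s≤s (s≤s (≤-trans (⊓-monoʳ-≤ (suc δ) (≤-trans (n≤1+n _) (≤-reflexive (cong suc (sym (∸-+-assoc N 1 δ))))))
                                (n≤1+n _))) ,
               s≤s (s≤s (s≤s (⊓-mono-≤ (n≤1+n δ) (≤-reflexive (∸-+-assoc N 1 δ)))))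

  pDist-RQ : ∀ δ → pDist Q (suc δ) ≈₁ pDist R δ
  pDist-RQ δ = s≤s (≤-trans (⊓-monoʳ-≤ (suc δ) (n≤1+n _)) (n≤1+n _)) ,
               s≤s (⊓-+-≤ 1 (n≤1+n (suc δ)) ≤-refl)

  pDist-at-N : ∀ k → pDist k N ≤ layer k + (1 ∸ shortcut k)
  pDist-at-N k = +-monoʳ-≤ (layer k) (≤-trans (m⊓n≤n N _) (≤-reflexive (begin
    n ∸ shortcut k ∸ N       ≡⟨ ∸-+-assoc n (shortcut k) N ⟩
    n ∸ (shortcut k + N)     ≡⟨ cong₂ _∸_ (+-comm 1 N) (+-comm (shortcut k) N) ⟩
    (N + 1) ∸ (N + shortcut k) ≡⟨ [m+n]∸[m+o]≡n∸o N 1 (shortcut k) ⟩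
    1 ∸ shortcut k           ∎)))
    where open ≡-Reasoning

  -- A chord from offset δ leads to offset 1 + δ mod n; the conditions on layers cover the
  -- wrap-around at δ = N.
  pDist-across : ∀ k k′ → (∀ δ → pDist k′ (suc δ) ≈₁ pDist k δ) →
                 layer k′ ≤ suc (layer k) → layer k + (1 ∸ shortcut k) ≤ suc (layer k′) →
                 ∀ δ → δ < n → pDist k′ (suc δ % n) ≈₁ pDist k δ
  pDist-across k k′ shifted lower upper δ δ<n with m≤n⇒m<n∨m≡n δ<n
  ... | inj₁ 1+δ<n = subst (λ x → pDist k′ x ≈₁ pDist k δ) (sym (m<n⇒m%n≡m 1+δ<n)) (shifted δ)
  ... | inj₂ refl = subst (λ x → pDist k′ x ≈₁ pDist k N) (sym (n%n≡0 n))
    ( ≤-trans (≤-reflexive (+-identityʳ (layer k′))) (≤-trans lower (s≤s (m≤m+n (layer k) _)))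
    , ≤-trans (pDist-at-N k) (≤-trans upper (s≤s (≤-reflexive (sym (+-identityʳ (layer k′)))))))

  pDistFrom : Fin n → Vertex n → ℕ
  pDistFrom j (k , i) = pDist k (offset j i)

  pDistFrom-arc : ∀ j {u v} → ΔArc u v → pDistFrom j v ≈₁ pDistFrom j u
  pDistFrom-arc j (pp t) rewrite offset-next j t =
    pDist-across P P pDist-PP z≤n ≤-refl (offset j t) (offset<n j t)
  pDistFrom-arc j (pq t) = ≤-refl , ≤-trans (n≤1+n _) (n≤1+n _)
  pDistFrom-arc j (qr t) = pDist-QR (offset j t)
  pDistFrom-arc j (rs t) = pDist-RS (offset j t)
  pDistFrom-arc j (sr t) rewrite offset-next j t =
    pDist-across S R pDist-SR (s≤s (s≤s z≤n)) ≤-refl (offset j t) (offset<n j t)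
  pDistFrom-arc j (rq t) rewrite offset-next j t =
    pDist-across R Q pDist-RQ (s≤s z≤n) ≤-refl (offset j t) (offset<n j t)

  pDistFrom-adjacent : ∀ j {u v} → ΔAdj u v → pDistFrom j v ≤ suc (pDistFrom j u)
  pDistFrom-adjacent j (inj₁ a) = proj₁ (pDistFrom-arc j a)
  pDistFrom-adjacent j (inj₂ a) = proj₂ (pDistFrom-arc j a)

  pDistFrom-≤-walk : ∀ j {v k} → Walk ΔAdj (P , j) v k → pDistFrom j v ≤ k
  pDistFrom-≤-walk j {v} {k} w =
    subst (λ x → pDistFrom j v ≤ pDist P x + k) (offset-self j) (Walk-lipschitz (pDistFrom j) (pDistFrom-adjacent j) w)

  p-walk : ∀ d i → Walk ΔAdj (P , i) (P , advance d i) d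
  p-walk zero i = here
  p-walk (suc d) i = snocʷ (p-walk d i) (inj₁ (pp (advance d i)))

  p-walk-home : ∀ j a b → a + b ≡ n → Walk ΔAdj (P , advance b j) (P , j) a
  p-walk-home j a b a+b≡n = subst (λ i → Walk ΔAdj (P , advance b j) (P , i) a) lands (p-walk a (advance b j))
    where
    lands : advance a (advance b j) ≡ j
    lands = trans (sym (advance-+ a b j)) (trans (cong (λ d → advance d j) a+b≡n) (advance-period j))

  forward-walk : ∀ j δ k → Walk ΔAdj (P , j) (k , advance δ j) (layer k + δ)
  forward-walk j δ P = p-walk δ j
  forward-walk j δ Q = snocʷ (p-walk δ j) (inj₁ (pq _))
  forward-walk j δ R = snocʷ (snocʷ (p-walk δ j) (inj₁ (pq _))) (inj₁ (qr _))
  forward-walk j δ S = snocʷ (snocʷ (snocʷ (p-walk δ j) (inj₁ (pq _))) (inj₁ (qr _))) (inj₁ (rs _))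

  backward-walk-P : ∀ j δ → δ ≤ n → Walk ΔAdj (P , advance δ j) (P , j) (n ∸ δ)
  backward-walk-P j δ δ≤n = p-walk-home j (n ∸ δ) δ (m∸n+n≡m δ≤n)

  backward-walk-Q : ∀ j δ → δ ≤ n → Walk ΔAdj (Q , advance δ j) (P , j) (1 + (n ∸ δ))
  backward-walk-Q j δ δ≤n = step (inj₂ (pq _)) (backward-walk-P j δ δ≤n)

  backward-walk-R : ∀ j δ → δ ≤ N → Walk ΔAdj (R , advance δ j) (P , j) (2 + (N ∸ δ))
  backward-walk-R j δ δ≤N = step (inj₁ (rq _)) (backward-walk-Q j (suc δ) (s≤s δ≤N))

  backward-walk-S : ∀ j δ → δ < N → Walk ΔAdj (S , advance δ j) (P , j) (3 + (N ∸ 1 ∸ δ))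
  backward-walk-S j δ δ<N = step (inj₁ (sr _))
    (subst (Walk ΔAdj (R , advance (suc δ) j) (P , j) ∘ (2 +_)) (sym (∸-+-assoc N 1 δ)) (backward-walk-R j (suc δ) δ<N))

  backward-walk-S-N : ∀ j → Walk ΔAdj (S , advance N j) (P , j) 3
  backward-walk-S-N j = step (inj₁ (sr _)) (subst (λ i → Walk ΔAdj (R , i) (P , j) 2) (sym (advance-period j))
    (step (inj₂ (qr j)) (step (inj₂ (pq j)) here)))

  backward-walk : ∀ j δ k → δ < n → Walk ΔAdj (P , j) (k , advance δ j) (layer k + ((n ∸ shortcut k) ∸ δ))
  backward-walk j δ P δ<n = reverseʷ (backward-walk-P j δ (<⇒≤ δ<n))
  backward-walk j δ Q δ<n = reverseʷ (backward-walk-Q j δ (<⇒≤ δ<n))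
  backward-walk j δ R δ<n = reverseʷ (backward-walk-R j δ (s≤s⁻¹ δ<n))
  backward-walk j δ S δ<n with m≤n⇒m<n∨m≡n (s≤s⁻¹ δ<n)
  ... | inj₁ δ<N = reverseʷ (backward-walk-S j δ δ<N)
  ... | inj₂ refl = subst (Walk ΔAdj (P , j) (S , advance N j) ∘ (3 +_))
    (sym (trans (∸-+-assoc N 1 N) (m≤n⇒m∸n≡0 (n≤1+n N)))) (reverseʷ (backward-walk-S-N j))

  pDist-walk : ∀ j δ k → δ < n → Walk ΔAdj (P , j) (k , advance δ j) (pDist k δ)
  pDist-walk j δ k δ<n with δ ≤? (n ∸ shortcut k) ∸ δ
  ... | yes forward = subst (Walk ΔAdj (P , j) (k , advance δ j) ∘ (layer k +_))
    (sym (m≤n⇒m⊓n≡m forward)) (forward-walk j δ k)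
  ... | no backward = subst (Walk ΔAdj (P , j) (k , advance δ j) ∘ (layer k +_))
    (sym (m≥n⇒m⊓n≡n (<⇒≤ (≰⇒> backward)))) (backward-walk j δ k δ<n)

  Dist-from-p : ∀ j v → Dist ΔAdj (P , j) v (pDistFrom j v)
  Dist-from-p j (k , i) =
    subst (λ t → Walk ΔAdj (P , j) (k , t) (pDistFrom j (k , i))) (advance-offset j i)
          (pDist-walk j (offset j i) k (offset<n j i)) ,
    λ _ → pDistFrom-≤-walk j

module Landmarks (N m e : ℕ) (n≡m+m+e : suc N ≡ m + m + e) (e≤1 : e ≤ 1) (3≤m : 3 ≤ m) where
  open PDistance N

  -- Distances of k_x from the landmarks p₀, p₁ and pₘ, at offsets x, x − 1 and x − m (mod n).
  d₀ d₁ dₘ : Kind → ℕ → ℕ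
  d₀ k x = pDist k x
  d₁ k x = pDist k ((x + N) % n)
  dₘ k x = pDist k ((x + (m + e)) % n)

  e≡0⊎e≡1 : e ≡ 0 ⊎ e ≡ 1
  e≡0⊎e≡1 = n≤1⇒n≡0∨n≡1 e≤1

  1≤m : 1 ≤ m
  1≤m = ≤-trans (s≤s z≤n) 3≤m

  m<n : m < n
  m<n = subst (m <_) (sym n≡m+m+e) (begin
    suc m     ≡⟨ +-comm 1 m ⟩
    m + 1     ≤⟨ +-monoʳ-≤ m 1≤m ⟩
    m + m     ≤⟨ m≤m+n (m + m) e ⟩
    m + m + e ∎)
    where open ≤-Reasoning

  ∸-shortcut : ∀ w δ y → δ + y + w ≡ m + m + e → n ∸ w ∸ δ ≡ y
  ∸-shortcut w δ y eq = begin
    n ∸ w ∸ δ         ≡⟨ cong (λ t → t ∸ w ∸ δ) (trans n≡m+m+e (sym eq)) ⟩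
    δ + y + w ∸ w ∸ δ ≡⟨ cong (_∸ δ) (m+n∸n≡m (δ + y) w) ⟩
    δ + y ∸ δ         ≡⟨ m+n∸m≡n δ y ⟩
    y                 ∎
    where open ≡-Reasoning

  ringDist-forward : ∀ ℓ w δ y → δ + y + w ≡ m + m + e → δ ≤ y → ringDist ℓ w δ ≡ ℓ + δ
  ringDist-forward ℓ w δ y eq δ≤y = cong (ℓ +_) (trans (cong (δ ⊓_) (∸-shortcut w δ y eq)) (m≤n⇒m⊓n≡m δ≤y))

  ringDist-backward : ∀ ℓ w δ y → δ + y + w ≡ m + m + e → y ≤ δ → ringDist ℓ w δ ≡ ℓ + y
  ringDist-backward ℓ w δ y eq y≤δ = cong (ℓ +_) (trans (cong (δ ⊓_) (∸-shortcut w δ y eq)) (m≥n⇒m⊓n≡n y≤δ))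

  ringDist-beyond : ∀ ℓ w δ → n ≤ δ + w → ringDist ℓ w δ ≡ ℓ
  ringDist-beyond ℓ w δ n≤δ+w = begin
    ℓ + (δ ⊓ (n ∸ w ∸ δ))   ≡⟨ cong (λ t → ℓ + (δ ⊓ t)) (∸-+-assoc n w δ) ⟩
    ℓ + (δ ⊓ (n ∸ (w + δ))) ≡⟨ cong (λ t → ℓ + (δ ⊓ t)) (m≤n⇒m∸n≡0 (subst (n ≤_) (+-comm δ w) n≤δ+w)) ⟩
    ℓ + (δ ⊓ 0)             ≡⟨ cong (ℓ +_) (⊓-zeroʳ δ) ⟩
    ℓ + 0                   ≡⟨ +-identityʳ ℓ ⟩
    ℓ                       ∎
    where open ≡-Reasoning

  ringDist-% : ∀ ℓ w y → y ≤ n → ringDist ℓ w (y % n) ≡ ringDist ℓ w y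
  ringDist-% ℓ w y y≤n with m≤n⇒m<n∨m≡n y≤n
  ... | inj₁ y<n = cong (ringDist ℓ w) (m<n⇒m%n≡m y<n)
  ... | inj₂ refl = begin
    ringDist ℓ w (n % n) ≡⟨ cong (ringDist ℓ w) (n%n≡0 n) ⟩
    ℓ + 0                ≡⟨ +-identityʳ ℓ ⟩
    ℓ                    ≡⟨ ringDist-beyond ℓ w n (m≤m+n n w) ⟨
    ringDist ℓ w n       ∎
    where open ≡-Reasoning

  d₁-at-0 : ∀ ℓ w → ringDist ℓ w ((0 + N) % n) ≡ ringDist ℓ w N
  d₁-at-0 ℓ w = cong (ringDist ℓ w) (m<n⇒m%n≡m ≤-refl)

  d₁-suc : ∀ ℓ w x → x < n → ringDist ℓ w ((suc x + N) % n) ≡ ringDist ℓ w x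
  d₁-suc ℓ w x x<n = cong (ringDist ℓ w) (trans (cong (_% n) (sym (+-suc x N))) (trans ([m+n]%n≡m%n x n) (m<n⇒m%n≡m x<n)))

  dₘ-≤m : ∀ ℓ w x → x ≤ m → ringDist ℓ w ((x + (m + e)) % n) ≡ ringDist ℓ w (x + (m + e))
  dₘ-≤m ℓ w x x≤m = ringDist-% ℓ w (x + (m + e)) (begin
    x + (m + e) ≤⟨ +-monoˡ-≤ (m + e) x≤m ⟩
    m + (m + e) ≡⟨ +-assoc m m e ⟨
    m + m + e   ≡⟨ n≡m+m+e ⟨
    n           ∎)
    where open ≤-Reasoning

  dₘ-m+ : ∀ ℓ w z → z < n → ringDist ℓ w ((m + z + (m + e)) % n) ≡ ringDist ℓ w z
  dₘ-m+ ℓ w z z<n = cong (ringDist ℓ w) (begin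
    (m + z + (m + e)) % n ≡⟨ cong (_% n) m+z+[m+e]≡z+n ⟩
    (z + n) % n           ≡⟨ [m+n]%n≡m%n z n ⟩
    z % n                 ≡⟨ m<n⇒m%n≡m z<n ⟩
    z                     ∎)
    where
    open ≡-Reasoning
    m+z+[m+e]≡z+n : m + z + (m + e) ≡ z + n
    m+z+[m+e]≡z+n = begin
      m + z + (m + e) ≡⟨ solve (m ∷ z ∷ e ∷ []) ⟩
      z + (m + m + e) ≡⟨ cong (z +_) n≡m+m+e ⟨
      z + n           ∎

  -- In the generic rising (falling) range d₀ + dₘ exceeds m (m + e) by excess k.
  excess : Kind → ℕ
  excess k = layer k + layer k ∸ shortcut k

  -- Certificates for the possible triples (d₀, dₘ, x) of a vertex of kind k at position x, when
  -- d₀ − d₁ is 1, −1 or 0 respectively; each family lists a generic range and a few exceptional positions.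
  data Rising : ℕ → ℕ → ℕ → Kind → Set where
    rising : ∀ {k x c} → x + shortcut k ≤ m → layer k + x + c ≡ m + excess k → Rising (layer k + x) c x k
    rising-R-at-m : Rising (2 + m) 2 m R
    rising-S-at-m-1 : ∀ {x} → 1 + x ≡ m → Rising (3 + x) 3 x S

  data Falling : ℕ → ℕ → ℕ → Kind → Set where
    falling : ∀ {k a c x} → a + x ≡ n + (layer k ∸ shortcut k) → a + c ≡ m + (e + excess k) → Falling a c x k
    falling-P-at-0 : Falling 0 m 0 P
    falling-Q-at-0 : Falling 1 (suc m) 0 Q

  data Level : ℕ → ℕ → ℕ → Kind → Set where
    level-R-at-0 : Level 2 (suc m) 0 R
    level-S-at-0 : Level 3 (suc m) 0 S
    level-S-at-N : Level 3 (2 + m) N S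
    level-R-at-m : e ≡ 0 → Level (suc m) 2 m R
    level-P-at-m+1 : e ≡ 1 → Level m 1 (suc m) P
    level-Q-at-m+1 : e ≡ 1 → Level (suc m) 2 (suc m) Q
    level-S-at-m : e ≡ 1 → Level (2 + m) 3 m S

  Class : Kind → ℕ → Set
  Class k x = (suc (d₁ k x) ≡ d₀ k x × Rising (d₀ k x) (dₘ k x) x k)
            ⊎ (suc (d₀ k x) ≡ d₁ k x × Falling (d₀ k x) (dₘ k x) x k)
            ⊎ (d₀ k x ≡ d₁ k x × Level (d₀ k x) (dₘ k x) x k)

  -- An excess of 1 occurs only for q_0 with n odd.
  kindOfExcess : ℕ → Kind
  kindOfExcess 0 = P
  kindOfExcess 1 = Q
  kindOfExcess 2 = Q
  kindOfExcess 3 = R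
  kindOfExcess _ = S

  kindOfExcess-excess : ∀ k → kindOfExcess (excess k) ≡ k
  kindOfExcess-excess P = refl
  kindOfExcess-excess Q = refl
  kindOfExcess-excess R = refl
  kindOfExcess-excess S = refl

  risingKind : ℕ → ℕ → Kind
  risingKind 4 2 = R
  risingKind t _ = kindOfExcess t

  risingVertex : ℕ → ℕ → Kind × ℕ
  risingVertex a c = k , a ∸ layer k
    where k = risingKind (a + c ∸ m) c

  fallingVertex : ℕ → ℕ → Kind × ℕ
  fallingVertex a c = k , (n + (layer k ∸ shortcut k) ∸ a) % n
    where k = kindOfExcess (a + c ∸ m ∸ e)

  levelMiddle : ℕ → Kind × ℕ
  levelMiddle 0 = R , m
  levelMiddle _ = Q , suc m

  levelByExcess : ℕ → ℕ → ℕ → Kind × ℕ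
  levelByExcess 0 _ 1 = P , suc m
  levelByExcess 0 _ 2 = levelMiddle e
  levelByExcess 0 _ _ = S , m
  levelByExcess 1 2 _ = R , 0
  levelByExcess 1 _ _ = S , 0
  levelByExcess _ _ _ = S , N

  levelVertex : ℕ → ℕ → Kind × ℕ
  levelVertex a c = levelByExcess (c ∸ m) a c

  ∸-excess : ∀ {a t} → a ≡ m + t → a ∸ m ≡ t
  ∸-excess {t = t} refl = m+n∸m≡n m t

  risingKind-excess : ∀ k {x c} → x + shortcut k ≤ m → layer k + x + c ≡ m + excess k →
                      risingKind (excess k) c ≡ k
  risingKind-excess P _ _ = refl
  risingKind-excess Q _ _ = refl
  risingKind-excess R _ _ = refl
  risingKind-excess S {x} {c} x+2≤m sum with +-cancelˡ-≤ (3 + x) 3 c (begin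
    3 + x + 3 ≡⟨ solve (x ∷ []) ⟩
    x + 2 + 4 ≤⟨ +-monoˡ-≤ 4 x+2≤m ⟩
    m + 4     ≡⟨ sum ⟨
    3 + x + c ∎)
    where open ≤-Reasoning
  ... | s≤s (s≤s (s≤s _)) = refl

  rising-vertex : ∀ {a c x k} → Rising a c x k → risingVertex a c ≡ (k , x)
  rising-vertex {x = x} {k} (rising x+s≤m sum)
    rewrite ∸-excess sum | risingKind-excess k x+s≤m sum = cong (k ,_) (m+n∸m≡n (layer k) x)
  rising-vertex rising-R-at-m rewrite ∸-excess {2 + m + 2} {4} (solve (m ∷ [])) = refl
  rising-vertex {x = x} (rising-S-at-m-1 refl) rewrite ∸-excess {3 + x + 3} {5} (solve (x ∷ [])) = refl

  kindOfExcess-2∸e : ∀ {e} → e ≤ 1 → kindOfExcess (2 ∸ e) ≡ Q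
  kindOfExcess-2∸e z≤n = refl
  kindOfExcess-2∸e (s≤s z≤n) = refl

  falling-vertex : ∀ {a c x k} → x < n → Falling a c x k → fallingVertex a c ≡ (k , x)
  falling-vertex {a} {x = x} {k} x<n (falling position sum)
    rewrite ∸-excess sum | m+n∸m≡n e (excess k) | kindOfExcess-excess k = cong (k ,_) (begin
      (n + (layer k ∸ shortcut k) ∸ a) % n ≡⟨ cong (λ t → (t ∸ a) % n) position ⟨
      (a + x ∸ a) % n                      ≡⟨ cong (_% n) (m+n∸m≡n a x) ⟩
      x % n                                ≡⟨ m<n⇒m%n≡m x<n ⟩
      x                                    ∎)
    where open ≡-Reasoning
  falling-vertex _ falling-P-at-0 rewrite n∸n≡0 m | 0∸n≡0 e =
    cong (P ,_) (trans (cong (_% n) (+-identityʳ n)) (n%n≡0 n))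
  falling-vertex _ falling-Q-at-0 rewrite ∸-excess {1 + suc m} {2} (solve (m ∷ [])) | kindOfExcess-2∸e e≤1 =
    cong (Q ,_) (trans (cong (_% n) (m+n∸n≡m n 1)) (n%n≡0 n))

  level-vertex : ∀ {a c x k} → Level a c x k → levelVertex a c ≡ (k , x)
  level-vertex level-R-at-0 rewrite ∸-excess {suc m} {1} (+-comm 1 m) = refl
  level-vertex level-S-at-0 rewrite ∸-excess {suc m} {1} (+-comm 1 m) = refl
  level-vertex level-S-at-N rewrite ∸-excess {2 + m} {2} (+-comm 2 m) = refl
  level-vertex (level-R-at-m refl) rewrite m≤n⇒m∸n≡0 (≤-trans (n≤1+n 2) 3≤m) = refl
  level-vertex (level-P-at-m+1 refl) rewrite m≤n⇒m∸n≡0 (≤-trans (s≤s z≤n) 3≤m) = refl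
  level-vertex (level-Q-at-m+1 refl) rewrite m≤n⇒m∸n≡0 (≤-trans (n≤1+n 2) 3≤m) = refl
  level-vertex (level-S-at-m refl) rewrite m≤n⇒m∸n≡0 3≤m = refl

  decode : ℕ → ℕ → ℕ → Kind × ℕ
  decode a b c with a ≟ suc b | b ≟ suc a
  ... | yes _ | _ = risingVertex a c
  ... | no _ | yes _ = fallingVertex a c
  ... | no _ | no _ = levelVertex a c

  Class⇒decode : ∀ {k x} → x < n → Class k x → decode (d₀ k x) (d₁ k x) (dₘ k x) ≡ (k , x)
  Class⇒decode {k} {x} x<n cls with d₀ k x ≟ suc (d₁ k x) | d₁ k x ≟ suc (d₀ k x) | cls
  ... | yes _ | _ | inj₁ (_ , r) = rising-vertex r
  ... | yes a≡1+b | _ | inj₂ (inj₁ (1+a≡b , _)) = ⊥-elim (m≢1+n+m (d₁ k x) {1} (sym (trans (sym (cong suc a≡1+b)) 1+a≡b)))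
  ... | yes a≡1+b | _ | inj₂ (inj₂ (a≡b , _)) = ⊥-elim (1+n≢n (trans (sym a≡1+b) a≡b))
  ... | no a≢1+b | _ | inj₁ (1+b≡a , _) = ⊥-elim (a≢1+b (sym 1+b≡a))
  ... | no _ | yes _ | inj₂ (inj₁ (_ , f)) = falling-vertex x<n f
  ... | no _ | yes b≡1+a | inj₂ (inj₂ (a≡b , _)) = ⊥-elim (1+n≢n (trans (sym b≡1+a) (sym a≡b)))
  ... | no _ | no b≢1+a | inj₂ (inj₁ (1+a≡b , _)) = ⊥-elim (b≢1+a (sym 1+a≡b))
  ... | no _ | no _ | inj₂ (inj₂ (_ , l)) = level-vertex l

  shortcut+excess : ∀ k → shortcut k + excess k ≡ layer k + layer k
  shortcut+excess P = refl
  shortcut+excess Q = refl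
  shortcut+excess R = refl
  shortcut+excess S = refl

  rising-values : ∀ ℓ w x d → m ≡ suc x + w + d →
                  ringDist ℓ w (suc x) ≡ ℓ + suc x ×
                  ringDist ℓ w ((suc x + N) % n) ≡ ℓ + x ×
                  ringDist ℓ w ((suc x + (m + e)) % n) ≡ ℓ + d
  rising-values ℓ w x d refl =
      ringDist-forward ℓ w (suc x) (suc x + w + d + d + e) (solve (x ∷ w ∷ d ∷ e ∷ []))
        (m+k≡n⇒m≤n (w + d + d + e) (solve (x ∷ w ∷ d ∷ e ∷ [])))
    , trans (d₁-suc ℓ w x x<n) (ringDist-forward ℓ w x (2 + x + w + d + d + e) (solve (x ∷ w ∷ d ∷ e ∷ []))
        (m+k≡n⇒m≤n (2 + w + d + d + e) (solve (x ∷ w ∷ d ∷ e ∷ []))))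
    , trans (dₘ-≤m ℓ w (suc x) (m+k≡n⇒m≤n (w + d) (sym (+-assoc (suc x) w d))))
        (ringDist-backward ℓ w _ d (solve (x ∷ w ∷ d ∷ e ∷ []))
        (m+k≡n⇒m≤n (suc x + suc x + w + e) (solve (x ∷ w ∷ d ∷ e ∷ []))))
    where
    x<n : x < n
    x<n = subst (x <_) (sym n≡m+m+e) (m+k≡n⇒m≤n (w + d + (suc x + w + d) + e) (solve (x ∷ w ∷ d ∷ e ∷ [])))

  rising-class-split : ∀ k x d → m ≡ suc x + shortcut k + d → Class k (suc x)
  rising-class-split k x d m≡ with rising-values (layer k) (shortcut k) x d m≡
  ... | d₀≡ , d₁≡ , dₘ≡ =
    inj₁ ( trans (cong suc d₁≡) (trans (sym (+-suc (layer k) x)) (sym d₀≡))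
         , subst₂ (λ a c → Rising a c (suc x) k) (sym d₀≡) (sym dₘ≡) (rising bound sum))
    where
    bound : suc x + shortcut k ≤ m
    bound = m+k≡n⇒m≤n d (sym m≡)
    sum : layer k + suc x + (layer k + d) ≡ m + excess k
    sum = trans (regroup (layer k) (shortcut k) (excess k) (shortcut+excess k)) (cong (_+ excess k) (sym m≡))
      where
      regroup : ∀ ℓ s ex → s + ex ≡ ℓ + ℓ → ℓ + suc x + (ℓ + d) ≡ suc x + s + d + ex
      regroup ℓ s ex s+ex≡ℓ+ℓ = begin
        ℓ + suc x + (ℓ + d)    ≡⟨ solve (x ∷ d ∷ ℓ ∷ []) ⟩
        suc x + d + (ℓ + ℓ)    ≡⟨ cong (suc x + d +_) s+ex≡ℓ+ℓ ⟨
        suc x + d + (s + ex)   ≡⟨ solve (x ∷ d ∷ s ∷ ex ∷ []) ⟩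
        suc x + s + d + ex     ∎
        where open ≡-Reasoning

  rising-class : ∀ k x → suc x + shortcut k ≤ m → Class k (suc x)
  rising-class k x bound with m≤n⇒∃[o]m+o≡n bound
  ... | d , refl = rising-class-split k x d refl

  shortcut+lift : ∀ k → shortcut k + (layer k ∸ shortcut k) ≡ layer k
  shortcut+lift P = refl
  shortcut+lift Q = refl
  shortcut+lift R = refl
  shortcut+lift S = refl

  falling-values : ∀ ℓ w x z y → suc x ≡ m + z → m + e ≡ z + w + y → 1 + y ≤ x → z ≤ m + y →
                   ringDist ℓ w (suc x) ≡ ℓ + y ×
                   ringDist ℓ w ((suc x + N) % n) ≡ ℓ + suc y ×
                   ringDist ℓ w ((suc x + (m + e)) % n) ≡ ℓ + z
  falling-values ℓ w x z y 1+x≡m+z m+e≡ 1+y≤x z≤m+y =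
      ringDist-backward ℓ w (suc x) y d₀-split (≤-trans (n≤1+n y) (s≤s (≤-trans (n≤1+n y) 1+y≤x)))
    , trans (d₁-suc ℓ w x x<n) (ringDist-backward ℓ w x (suc y) d₁-split 1+y≤x)
    , trans (cong (λ t → ringDist ℓ w ((t + (m + e)) % n)) 1+x≡m+z)
        (trans (dₘ-m+ ℓ w z z<n) (ringDist-forward ℓ w z (m + y) dₘ-split z≤m+y))
    where
    open ≡-Reasoning
    d₀-split : suc x + y + w ≡ m + m + e
    d₀-split = begin
      suc x + y + w   ≡⟨ cong (λ t → t + y + w) 1+x≡m+z ⟩
      m + z + y + w   ≡⟨ solve (m ∷ z ∷ y ∷ w ∷ []) ⟩
      m + (z + w + y) ≡⟨ cong (m +_) m+e≡ ⟨
      m + (m + e)     ≡⟨ +-assoc m m e ⟨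
      m + m + e       ∎
    d₁-split : x + suc y + w ≡ m + m + e
    d₁-split = trans (cong (_+ w) (+-suc x y)) d₀-split
    dₘ-split : z + (m + y) + w ≡ m + m + e
    dₘ-split = begin
      z + (m + y) + w ≡⟨ solve (m ∷ z ∷ y ∷ w ∷ []) ⟩
      m + (z + w + y) ≡⟨ cong (m +_) m+e≡ ⟨
      m + (m + e)     ≡⟨ +-assoc m m e ⟨
      m + m + e       ∎
    x<n : x < n
    x<n = subst (x <_) (sym n≡m+m+e) (m+k≡n⇒m≤n (y + w) (trans (sym (+-assoc (suc x) y w)) d₀-split))
    z<n : z < n
    z<n = subst (z <_) (sym n≡m+m+e) (≤-trans (m<m+n z (≤-trans (≤-trans (s≤s z≤n) 3≤m) (m≤m+n m y)))
                                               (≤-trans (m≤m+n _ w) (≤-reflexive dₘ-split)))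

  falling-class-split : ∀ k x z y → suc x ≡ m + z → m + e ≡ z + shortcut k + y → 1 + y ≤ x → z ≤ m + y →
                        Class k (suc x)
  falling-class-split k x z y 1+x≡m+z m+e≡ 1+y≤x z≤m+y
    with falling-values (layer k) (shortcut k) x z y 1+x≡m+z m+e≡ 1+y≤x z≤m+y
  ... | d₀≡ , d₁≡ , dₘ≡ =
    inj₂ (inj₁ ( trans (cong suc d₀≡) (trans (sym (+-suc (layer k) y)) (sym d₁≡))
               , subst₂ (λ a c → Falling a c (suc x) k) (sym d₀≡) (sym dₘ≡) (falling position sum)))
    where
    open ≡-Reasoning
    position : layer k + y + suc x ≡ n + (layer k ∸ shortcut k)
    position = begin
      layer k + y + suc x                                ≡⟨ cong (layer k + y +_) 1+x≡m+z ⟩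
      layer k + y + (m + z)                              ≡⟨ regroup (layer k) (shortcut k) (layer k ∸ shortcut k) (shortcut+lift k) ⟩
      m + (z + shortcut k + y) + (layer k ∸ shortcut k)  ≡⟨ cong (λ t → m + t + (layer k ∸ shortcut k)) m+e≡ ⟨
      m + (m + e) + (layer k ∸ shortcut k)               ≡⟨ cong (_+ (layer k ∸ shortcut k)) (trans (sym (+-assoc m m e)) (sym n≡m+m+e)) ⟩
      n + (layer k ∸ shortcut k)                         ∎
      where
      regroup : ∀ ℓ s lift → s + lift ≡ ℓ → ℓ + y + (m + z) ≡ m + (z + s + y) + lift
      regroup ℓ s lift s+lift≡ℓ = begin
        ℓ + y + (m + z)          ≡⟨ cong (λ t → t + y + (m + z)) s+lift≡ℓ ⟨
        s + lift + y + (m + z)   ≡⟨ solve (s ∷ lift ∷ y ∷ m ∷ z ∷ []) ⟩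
        m + (z + s + y) + lift   ∎
    sum : layer k + y + (layer k + z) ≡ m + (e + excess k)
    sum = begin
      layer k + y + (layer k + z)    ≡⟨ regroup (layer k) (shortcut k) (excess k) (shortcut+excess k) ⟩
      z + shortcut k + y + excess k  ≡⟨ cong (_+ excess k) m+e≡ ⟨
      m + e + excess k               ≡⟨ +-assoc m e (excess k) ⟩
      m + (e + excess k)             ∎
      where
      regroup : ∀ ℓ s ex → s + ex ≡ ℓ + ℓ → ℓ + y + (ℓ + z) ≡ z + s + y + ex
      regroup ℓ s ex s+ex≡ℓ+ℓ = begin
        ℓ + y + (ℓ + z)   ≡⟨ solve (ℓ ∷ y ∷ z ∷ []) ⟩
        y + z + (ℓ + ℓ)   ≡⟨ cong (y + z +_) s+ex≡ℓ+ℓ ⟨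
        y + z + (s + ex)  ≡⟨ solve (s ∷ ex ∷ y ∷ z ∷ []) ⟩
        z + s + y + ex    ∎

  beyond-m : ∀ {z} → m + z < n → suc z ≤ m + e
  beyond-m {z} m+z<n = +-cancelˡ-≤ m (suc z) (m + e)
    (subst₂ _≤_ (sym (+-suc m z)) (trans n≡m+m+e (+-assoc m m e)) m+z<n)

  falling-class : ∀ k z → m + z < n → z + shortcut k ≤ m + e → e + 2 ≤ z + z + shortcut k → Class k (m + z)
  falling-class k z m+z<n z+s≤m+e e+2≤2z+s with m≤n⇒∃[o]m+o≡n z+s≤m+e
  ... | y , z+s+y≡m+e = subst (Class k) (suc-pred (m + z))
    (falling-class-split k (pred (m + z)) z y (suc-pred (m + z)) (sym z+s+y≡m+e)
       (s≤s⁻¹ (subst (2 + y ≤_) (sym (suc-pred (m + z))) (2+y≤m+z (shortcut k) z+s+y≡m+e e+2≤2z+s)))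
       (z≤m+y (shortcut k) z+s+y≡m+e (2z+s≤n (shortcut k) z+s≤m+e)))
    where
    open ≤-Reasoning
    instance
      m+z≢0 : NonZero (m + z)
      m+z≢0 = >-nonZero (≤-trans (≤-trans (s≤s z≤n) 3≤m) (m≤m+n m z))
    2+y≤m+z : ∀ s {y} → z + s + y ≡ m + e → e + 2 ≤ z + z + s → 2 + y ≤ m + z
    2+y≤m+z s {y} z+s+y≡m+e e+2≤2z+s = +-cancelˡ-≤ (z + s) (2 + y) (m + z) (begin
      z + s + (2 + y)  ≡⟨ solve (z ∷ s ∷ y ∷ []) ⟩
      z + s + y + 2    ≡⟨ cong (_+ 2) z+s+y≡m+e ⟩
      m + e + 2        ≡⟨ +-assoc m e 2 ⟩
      m + (e + 2)      ≤⟨ +-monoʳ-≤ m e+2≤2z+s ⟩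
      m + (z + z + s)  ≡⟨ solve (m ∷ z ∷ s ∷ []) ⟩
      z + s + (m + z)  ∎)
    2z+s≤n : ∀ s → z + s ≤ m + e → z + z + s ≤ m + m + e
    2z+s≤n s z+s≤m+e = s≤s⁻¹ (begin
      suc (z + z + s)        ≡⟨ +-assoc (suc z) z s ⟩
      suc z + (z + s)        ≤⟨ +-mono-≤ (beyond-m m+z<n) z+s≤m+e ⟩
      m + e + (m + e)        ≡⟨ solve (m ∷ e ∷ []) ⟩
      m + m + e + e          ≤⟨ +-monoʳ-≤ (m + m + e) e≤1 ⟩
      m + m + e + 1          ≡⟨ +-comm (m + m + e) 1 ⟩
      suc (m + m + e)        ∎)
    z≤m+y : ∀ s {y} → z + s + y ≡ m + e → z + z + s ≤ m + m + e → z ≤ m + y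
    z≤m+y s {y} z+s+y≡m+e 2z+s≤n = +-cancelʳ-≤ (z + s) z (m + y) (begin
      z + (z + s)      ≡⟨ +-assoc z z s ⟨
      z + z + s        ≤⟨ 2z+s≤n ⟩
      m + m + e        ≡⟨ +-assoc m m e ⟩
      m + (m + e)      ≡⟨ cong (m +_) z+s+y≡m+e ⟨
      m + (z + s + y)  ≡⟨ solve (m ∷ z ∷ s ∷ y ∷ []) ⟩
      m + y + (z + s)  ∎)

  dₘ-at-0 : ∀ ℓ w y → y + w ≡ m → ringDist ℓ w ((0 + (m + e)) % n) ≡ ℓ + y
  dₘ-at-0 ℓ w y y+w≡m = trans (dₘ-≤m ℓ w 0 z≤n)
    (ringDist-backward ℓ w (m + e) y (begin
      m + e + y + w   ≡⟨ solve (m ∷ e ∷ y ∷ w ∷ []) ⟩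
      m + (y + w) + e ≡⟨ cong (λ t → m + t + e) y+w≡m ⟩
      m + m + e       ∎) (≤-trans (m≤m+n y w) (≤-trans (≤-reflexive y+w≡m) (m≤m+n m e))))
    where open ≡-Reasoning

  dₘ-beyond : ∀ ℓ w x → x ≤ m → m ≤ x + w → ringDist ℓ w ((x + (m + e)) % n) ≡ ℓ
  dₘ-beyond ℓ w x x≤m m≤x+w = trans (dₘ-≤m ℓ w x x≤m) (ringDist-beyond ℓ w (x + (m + e)) (begin
    n               ≡⟨ trans n≡m+m+e (+-assoc m m e) ⟩
    m + (m + e)     ≤⟨ +-monoˡ-≤ (m + e) m≤x+w ⟩
    x + w + (m + e) ≡⟨ solve (x ∷ w ∷ m ∷ e ∷ []) ⟩
    x + (m + e) + w ∎))
    where open ≤-Reasoning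

  classify-P-at-0 : Class P 0
  classify-P-at-0 = inj₂ (inj₁ (sym d₁≡1 , subst (λ c → Falling 0 c 0 P) (sym (dₘ-at-0 0 0 m (+-identityʳ m))) falling-P-at-0))
    where
    d₁≡1 : d₁ P 0 ≡ 1
    d₁≡1 = trans (d₁-at-0 0 0) (ringDist-backward 0 0 N 1 (trans (+-identityʳ (N + 1)) (trans (+-comm N 1) n≡m+m+e)) 1≤N)
      where
      1≤N : 1 ≤ N
      1≤N = s≤s⁻¹ (≤-trans (s≤s 1≤m) m<n)

  classify-P-at-m+1 : e ≡ 1 → Class P (suc m)
  classify-P-at-m+1 refl =
    inj₂ (inj₂ (trans d₀≡m (sym d₁≡m) , subst₂ (λ a c → Level a c (suc m) P) (sym d₀≡m) (sym dₘ≡1) (level-P-at-m+1 refl)))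
    where
    d₀≡m : d₀ P (suc m) ≡ m
    d₀≡m = ringDist-backward 0 0 (suc m) m (solve (m ∷ [])) (n≤1+n m)
    d₁≡m : d₁ P (suc m) ≡ m
    d₁≡m = trans (d₁-suc 0 0 m m<n) (ringDist-forward 0 0 m (suc m) (solve (m ∷ [])) (n≤1+n m))
    dₘ≡1 : dₘ P (suc m) ≡ 1
    dₘ≡1 = begin
      ringDist 0 0 ((suc m + (m + 1)) % n) ≡⟨ cong (λ t → ringDist 0 0 ((t + (m + 1)) % n)) (+-comm 1 m) ⟩
      ringDist 0 0 ((m + 1 + (m + 1)) % n) ≡⟨ dₘ-m+ 0 0 1 (≤-trans (s≤s 1≤m) m<n) ⟩
      ringDist 0 0 1                      ≡⟨ ringDist-forward 0 0 1 (m + m) (solve (m ∷ [])) (≤-trans 1≤m (m≤m+n m m)) ⟩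
      1                                   ∎
      where open ≡-Reasoning

  classify-P-beyond : ∀ z → suc (m + z) < n → Class P (suc (m + z))
  classify-P-beyond zero _ with e≡0⊎e≡1
  ... | inj₂ e≡1 = subst (Class P ∘ suc) (sym (+-identityʳ m)) (classify-P-at-m+1 e≡1)
  classify-P-beyond zero m+1<n | inj₁ refl = subst (Class P) (+-suc m 0)
    (falling-class P 1 (subst (_< n) (sym (+-suc m 0)) m+1<n) (subst (_≤ m + 0) (+-comm 0 1) (≤-trans 1≤m (m≤m+n m 0))) ≤-refl)
  classify-P-beyond (suc z) m+z+2<n = subst (Class P) (+-suc m (suc z))
    (falling-class P (suc (suc z)) m+z+2<n′ (≤-trans (≤-reflexive (+-identityʳ _)) (≤-trans (n≤1+n _) (beyond-m m+z+2<n′)))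
      (≤-trans (+-monoˡ-≤ 2 e≤1) (m+k≡n⇒m≤n (z + z + 1) (solve (z ∷ [])))))
    where
    m+z+2<n′ : m + suc (suc z) < n
    m+z+2<n′ = subst (_< n) (sym (+-suc m (suc z))) m+z+2<n

  classify-P : ∀ x → x < n → Class P x
  classify-P zero _ = classify-P-at-0
  classify-P (suc x) x<n with suc x ≤? m
  ... | yes 1+x≤m = rising-class P x (subst (_≤ m) (sym (+-identityʳ (suc x))) 1+x≤m)
  ... | no 1+x≰m with m≤n⇒∃[o]m+o≡n (s≤s⁻¹ (≰⇒> 1+x≰m))
  ...   | z , refl = classify-P-beyond z x<n

  -- pDist Q is 1 + pDist P, so every certificate for p_x lifts to one for q_x.
  classify-Q : ∀ x → x < n → Class Q x
  classify-Q x x<n with classify-P x x<n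
  ... | inj₁ (1+b≡a , r) = inj₁ (cong suc 1+b≡a , lift-rising r)
    where
    lift-rising : ∀ {a c} → Rising a c x P → Rising (suc a) (suc c) x Q
    lift-rising {c = c} (rising bound sum) = rising bound (begin
      suc (x + suc c)     ≡⟨ cong suc (+-suc x c) ⟩
      suc (suc (x + c))   ≡⟨ cong (suc ∘ suc) sum ⟩
      suc (suc (m + 0))   ≡⟨ solve (m ∷ []) ⟩
      m + 2               ∎)
      where open ≡-Reasoning
  ... | inj₂ (inj₁ (1+a≡b , f)) = inj₂ (inj₁ (cong suc 1+a≡b , lift-falling f))
    where
    lift-falling : ∀ {a c} → Falling a c x P → Falling (suc a) (suc c) x Q
    lift-falling {a} {c} (falling position sum) =
      falling (trans (cong suc position) (sym (+-suc n 0))) (begin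
        suc (a + suc c)        ≡⟨ cong suc (+-suc a c) ⟩
        suc (suc (a + c))      ≡⟨ cong (suc ∘ suc) sum ⟩
        suc (suc (m + (e + 0))) ≡⟨ solve (m ∷ e ∷ []) ⟩
        m + (e + 2)            ∎)
      where open ≡-Reasoning
    lift-falling falling-P-at-0 = falling-Q-at-0
  ... | inj₂ (inj₂ (a≡b , l)) = inj₂ (inj₂ (cong suc a≡b , lift-level l))
    where
    lift-level : ∀ {a c} → Level a c x P → Level (suc a) (suc c) x Q
    lift-level (level-P-at-m+1 e≡1) = level-Q-at-m+1 e≡1

  classify-R-at-0 : Class R 0
  classify-R-at-0 with m≤n⇒∃[o]m+o≡n 1≤m
  ... | m′ , refl = inj₂ (inj₂ (sym d₁≡2 , subst (λ c → Level 2 c 0 R) (sym (dₘ-at-0 2 1 m′ (+-comm m′ 1))) level-R-at-0))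
    where
    d₁≡2 : d₁ R 0 ≡ 2
    d₁≡2 = trans (d₁-at-0 2 1) (ringDist-beyond 2 1 N (≤-reflexive (+-comm 1 N)))

  classify-R-at-m : Class R (m + 0)
  classify-R-at-m with m≤n⇒∃[o]m+o≡n 1≤m | e≡0⊎e≡1
  ... | m′ , refl | inj₁ refl = subst (Class R) (sym (+-identityʳ (suc m′)))
    (inj₂ (inj₂ (trans d₀≡ (sym d₁≡) , subst₂ (λ a c → Level a c (suc m′) R) (sym d₀≡) (sym dₘ≡2) (level-R-at-m refl))))
    where
    d₀≡ : d₀ R (suc m′) ≡ suc (suc m′)
    d₀≡ = ringDist-backward 2 1 (suc m′) m′ (solve (m′ ∷ [])) (n≤1+n m′)
    d₁≡ : d₁ R (suc m′) ≡ suc (suc m′)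
    d₁≡ = trans (d₁-suc 2 1 m′ (≤-trans (n≤1+n _) m<n)) (ringDist-forward 2 1 m′ (suc m′) (solve (m′ ∷ [])) (n≤1+n m′))
    dₘ≡2 : dₘ R (suc m′) ≡ 2
    dₘ≡2 = dₘ-beyond 2 1 (suc m′) ≤-refl (m≤m+n _ 1)
  ... | m′ , refl | inj₂ refl = subst (Class R) (sym (+-identityʳ (suc m′)))
    (inj₁ (trans (cong suc d₁≡) (sym d₀≡) , subst₂ (λ a c → Rising a c (suc m′) R) (sym d₀≡) (sym dₘ≡2) rising-R-at-m))
    where
    d₀≡ : d₀ R (suc m′) ≡ 2 + suc m′
    d₀≡ = ringDist-forward 2 1 (suc m′) (suc m′) refl ≤-refl
    d₁≡ : d₁ R (suc m′) ≡ 2 + m′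
    d₁≡ = trans (d₁-suc 2 1 m′ (≤-trans (n≤1+n _) m<n))
                (ringDist-forward 2 1 m′ (suc (suc m′)) (solve (m′ ∷ [])) (≤-trans (n≤1+n m′) (n≤1+n _)))
    dₘ≡2 : dₘ R (suc m′) ≡ 2
    dₘ≡2 = dₘ-beyond 2 1 (suc m′) ≤-refl (m≤m+n _ 1)

  classify-R : ∀ x → x < n → Class R x
  classify-R x x<n with x <? m
  classify-R zero _ | yes _ = classify-R-at-0
  classify-R (suc x) _ | yes 1+x<m = rising-class R x (subst (_≤ m) (+-comm 1 (suc x)) 1+x<m)
  ... | no x≮m with m≤n⇒∃[o]m+o≡n (≮⇒≥ x≮m)
  ...   | zero , refl = classify-R-at-m
  ...   | suc z , refl = falling-class R (suc z) x<n (subst (_≤ m + e) (+-comm 1 (suc z)) (beyond-m x<n))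
                                      (≤-trans (+-monoˡ-≤ 2 e≤1) (m+k≡n⇒m≤n (z + z) (solve (z ∷ []))))

  classify-S-at-0 : Class S 0
  classify-S-at-0 with m≤n⇒∃[o]m+o≡n (≤-trans (n≤1+n 2) 3≤m)
  ... | m′ , refl = inj₂ (inj₂ (sym d₁≡3 , subst (λ c → Level 3 c 0 S) (sym (dₘ-at-0 3 2 m′ (+-comm m′ 2))) level-S-at-0))
    where
    d₁≡3 : d₁ S 0 ≡ 3
    d₁≡3 = trans (d₁-at-0 3 2) (ringDist-beyond 3 2 N (≤-trans (≤-reflexive (+-comm 1 N)) (+-monoʳ-≤ N (s≤s z≤n))))

  classify-S-at-m-1 : ∀ x → 2 + x ≡ m → Class S (suc x)
  classify-S-at-m-1 x refl =
    inj₁ (trans (cong suc d₁≡) (sym d₀≡) , subst₂ (λ a c → Rising a c (suc x) S) (sym d₀≡) (sym dₘ≡3) (rising-S-at-m-1 refl))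
    where
    d₀≡ : d₀ S (suc x) ≡ 3 + suc x
    d₀≡ = ringDist-forward 3 2 (suc x) (suc x + e) (solve (x ∷ e ∷ [])) (m≤m+n (suc x) e)
    d₁≡ : d₁ S (suc x) ≡ 3 + x
    d₁≡ = trans (d₁-suc 3 2 x (≤-trans (≤-trans (n≤1+n _) (n≤1+n _)) m<n))
               (ringDist-forward 3 2 x (x + 2 + e) (solve (x ∷ e ∷ [])) (≤-trans (m≤m+n x 2) (m≤m+n (x + 2) e)))
    dₘ≡3 : dₘ S (suc x) ≡ 3
    dₘ≡3 = dₘ-beyond 3 2 (suc x) (n≤1+n _) (m+k≡n⇒m≤n 1 (solve (x ∷ [])))

  classify-S-at-m : Class S (m + 0)
  classify-S-at-m with e≡0⊎e≡1
  ... | inj₁ refl = falling-class S 0 (subst (_< n) (sym (+-identityʳ m)) m<n) (≤-trans (≤-trans (n≤1+n 2) 3≤m) (m≤m+n m 0)) ≤-refl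
  ... | inj₂ refl with m≤n⇒∃[o]m+o≡n 1≤m
  ...   | m′ , refl = subst (Class S) (sym (+-identityʳ (suc m′)))
    (inj₂ (inj₂ (trans d₀≡ (sym d₁≡) , subst₂ (λ a c → Level a c (suc m′) S) (sym d₀≡) (sym dₘ≡3) (level-S-at-m refl))))
    where
    d₀≡ : d₀ S (suc m′) ≡ 2 + suc m′
    d₀≡ = ringDist-backward 3 2 (suc m′) m′ (solve (m′ ∷ [])) (n≤1+n m′)
    d₁≡ : d₁ S (suc m′) ≡ 2 + suc m′
    d₁≡ = trans (d₁-suc 3 2 m′ (≤-trans (n≤1+n _) m<n)) (ringDist-forward 3 2 m′ (suc m′) (solve (m′ ∷ [])) (n≤1+n m′))
    dₘ≡3 : dₘ S (suc m′) ≡ 3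
    dₘ≡3 = dₘ-beyond 3 2 (suc m′) ≤-refl (m≤m+n _ 2)

  classify-S-at-N : ∀ z → suc (m + suc z) ≡ n → Class S (m + suc z)
  classify-S-at-N z last with m≤n⇒∃[o]m+o≡n 1≤m
  ... | m′ , refl = inj₂ (inj₂ (trans d₀≡3 (sym d₁≡3) ,
    subst₂ (λ a c → Level a c (suc m′ + suc z) S) (sym d₀≡3) (sym dₘ≡) (subst (λ x → Level 3 (2 + suc m′) x S) x≡N level-S-at-N)))
    where
    open ≤-Reasoning
    x≡N : N ≡ suc m′ + suc z
    x≡N = sym (suc-injective last)
    d₀≡3 : d₀ S (suc m′ + suc z) ≡ 3
    d₀≡3 = ringDist-beyond 3 2 _ (begin
      n                      ≡⟨ last ⟨
      suc (suc m′ + suc z)   ≤⟨ m+k≡n⇒m≤n 1 (solve (m′ ∷ z ∷ [])) ⟩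
      suc m′ + suc z + 2     ∎)
    d₁≡3 : d₁ S (suc m′ + suc z) ≡ 3
    d₁≡3 = trans (d₁-suc 3 2 (m′ + suc z) (m+k≡n⇒m≤n 1 (trans (+-comm _ 1) last)))
                (ringDist-beyond 3 2 _ (begin
                  n                    ≡⟨ last ⟨
                  suc (suc m′ + suc z) ≡⟨ solve (m′ ∷ z ∷ []) ⟩
                  m′ + suc z + 2       ∎))
    m≤z+2 : suc m′ ≤ suc z + 1
    m≤z+2 = +-cancelˡ-≤ (suc m′) (suc m′) (suc z + 1) (m+k≡n⇒m≤n e (begin-equality
      suc m′ + suc m′ + e    ≡⟨ n≡m+m+e ⟨
      n                      ≡⟨ last ⟨
      suc (suc m′ + suc z)   ≡⟨ solve (m′ ∷ z ∷ []) ⟩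
      suc m′ + (suc z + 1)   ∎))
    dₘ≡ : dₘ S (suc m′ + suc z) ≡ 2 + suc m′
    dₘ≡ = trans (dₘ-m+ 3 2 (suc z) (m+k≡n⇒m≤n (suc m′) (trans (cong suc (+-comm (suc z) (suc m′))) last)))
               (ringDist-backward 3 2 (suc z) m′ split (s≤s⁻¹ (subst (suc m′ ≤_) (+-comm (suc z) 1) m≤z+2)))
      where
      split : suc z + m′ + 2 ≡ suc m′ + suc m′ + e
      split = begin-equality
        suc z + m′ + 2       ≡⟨ solve (m′ ∷ z ∷ []) ⟩
        suc (suc m′ + suc z) ≡⟨ last ⟩
        n                    ≡⟨ n≡m+m+e ⟩
        suc m′ + suc m′ + e  ∎

  classify-S : ∀ x → x < n → Class S x
  classify-S x x<n with x <? m
  classify-S zero _ | yes _ = classify-S-at-0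
  classify-S (suc x) _ | yes 1+x<m with 3 + x ≤? m
  ... | yes 3+x≤m = rising-class S x (subst (_≤ m) (+-comm 2 (suc x)) 3+x≤m)
  ... | no 3+x≰m = classify-S-at-m-1 x (≤-antisym 1+x<m (≮⇒≥ (λ 2+x<m → 3+x≰m 2+x<m)))
  classify-S x x<n | no x≮m with m≤n⇒∃[o]m+o≡n (≮⇒≥ x≮m)
  ... | zero , refl = classify-S-at-m
  ... | suc z , refl with m≤n⇒m<n∨m≡n x<n
  ...   | inj₂ last = classify-S-at-N z last
  ...   | inj₁ 1+x<n = falling-class S (suc z) x<n
    (subst (_≤ m + e) (+-comm 2 (suc z)) (beyond-m (subst (_< n) (sym (+-suc m (suc z))) 1+x<n)))
    (≤-trans (+-monoˡ-≤ 2 e≤1) (m+k≡n⇒m≤n (z + z + 1) (solve (z ∷ []))))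

  classify : ∀ k x → x < n → Class k x
  classify P = classify-P
  classify Q = classify-Q
  classify R = classify-R
  classify S = classify-S

  1<n : 1 < n
  1<n = ≤-trans (s≤s (s≤s z≤n)) (≤-trans (s≤s 1≤m) m<n)

  j₁ jₘ : Fin n
  j₁ = fromℕ< 1<n
  jₘ = fromℕ< m<n

  landmarks : List (Vertex n)
  landmarks = (P , fzero) ∷ (P , j₁) ∷ (P , jₘ) ∷ []

  pDistFrom-0 : ∀ k i → pDistFrom fzero (k , i) ≡ d₀ k (toℕ i)
  pDistFrom-0 k i = cong (pDist k) (trans ([m+n]%n≡m%n (toℕ i) n) (m<n⇒m%n≡m (toℕ<n i)))

  pDistFrom-1 : ∀ k i → pDistFrom j₁ (k , i) ≡ d₁ k (toℕ i)
  pDistFrom-1 k i = cong (λ t → pDist k ((toℕ i + (n ∸ t)) % n)) (toℕ-fromℕ< 1<n)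

  pDistFrom-m : ∀ k i → pDistFrom jₘ (k , i) ≡ dₘ k (toℕ i)
  pDistFrom-m k i = cong (λ t → pDist k ((toℕ i + t) % n)) (begin
    n ∸ toℕ jₘ       ≡⟨ cong (n ∸_) (toℕ-fromℕ< m<n) ⟩
    n ∸ m           ≡⟨ cong (_∸ m) (trans n≡m+m+e (+-assoc m m e)) ⟩
    m + (m + e) ∸ m ≡⟨ m+n∸m≡n m (m + e) ⟩
    m + e           ∎)
    where open ≡-Reasoning

  decode-correct : ∀ k (i : Fin n) → decode (d₀ k (toℕ i)) (d₁ k (toℕ i)) (dₘ k (toℕ i)) ≡ (k , toℕ i)
  decode-correct k i = Class⇒decode (toℕ<n i) (classify k (toℕ i) (toℕ<n i))

  landmarks-separate : ∀ u v → All (λ y → pDistFrom (proj₂ y) u ≡ pDistFrom (proj₂ y) v) landmarks → u ≡ v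
  landmarks-separate (k , i) (k′ , i′) (s₀ All.∷ s₁ All.∷ sₘ All.∷ All.[]) =
    cong₂ _,_ (cong proj₁ same) (toℕ-injective (cong proj₂ same))
    where
    open ≡-Reasoning
    same : (k , toℕ i) ≡ (k′ , toℕ i′)
    same = begin
      (k , toℕ i)                                                  ≡⟨ decode-correct k i ⟨
      decode (d₀ k (toℕ i)) (d₁ k (toℕ i)) (dₘ k (toℕ i))          ≡⟨ cong₂ (λ a → uncurry (decode a))
        (trans (sym (pDistFrom-0 k i)) (trans s₀ (pDistFrom-0 k′ i′)))
        (cong₂ _,_ (trans (sym (pDistFrom-1 k i)) (trans s₁ (pDistFrom-1 k′ i′)))
                   (trans (sym (pDistFrom-m k i)) (trans sₘ (pDistFrom-m k′ i′)))) ⟩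
      decode (d₀ k′ (toℕ i′)) (d₁ k′ (toℕ i′)) (dₘ k′ (toℕ i′))    ≡⟨ decode-correct k′ i′ ⟩
      (k′ , toℕ i′)                                                ∎

  landmarks-resolving : Resolving ΔAdj landmarks
  landmarks-resolving = Resolving-by-distances (pDistFrom ∘ proj₂) landmarks
    (Dist-from-p fzero All.∷ Dist-from-p j₁ All.∷ Dist-from-p jₘ All.∷ All.[]) landmarks-separate

  landmarks-unique : Unique.Unique landmarks
  landmarks-unique =
    (index≢ 0≢1 All.∷ index≢ 0≢m All.∷ All.[]) Unique.∷ (index≢ 1≢m All.∷ All.[]) Unique.∷ All.[] Unique.∷ Unique.[]
    where
    index≢ : ∀ {i j : Fin n} → toℕ i ≢ toℕ j → _≢_ {A = Vertex n} (P , i) (P , j)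
    index≢ i≢j = i≢j ∘ cong (toℕ ∘ proj₂)
    0≢1 : 0 ≢ toℕ j₁
    0≢1 eq = <⇒≢ (s≤s z≤n) (trans eq (toℕ-fromℕ< 1<n))
    0≢m : 0 ≢ toℕ jₘ
    0≢m eq = <⇒≢ 1≤m (trans eq (toℕ-fromℕ< m<n))
    1≢m : toℕ j₁ ≢ toℕ jₘ
    1≢m eq = <⇒≢ (≤-trans (s≤s (s≤s z≤n)) 3≤m) (trans (sym (toℕ-fromℕ< 1<n)) (trans eq (toℕ-fromℕ< m<n)))

≈₁-≢ : ∀ {a b} → a ≈₁ b → a ≢ b → a ≡ suc b ⊎ b ≡ suc a
≈₁-≢ {a} {b} (a≤1+b , b≤1+a) a≢b with <-cmp a b
... | tri< a<b _ _ = inj₂ (≤-antisym b≤1+a a<b)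
... | tri≈ _ a≡b _ = ⊥-elim (a≢b a≡b)
... | tri> _ _ b<a = inj₁ (≤-antisym a≤1+b b<a)

≈₁-distinct-monotone : ∀ {a b c} → a ≈₁ b → b ≈₁ c → a ≢ b → b ≢ c → a ≢ c →
                       (b ≡ suc a × c ≡ suc b) ⊎ (a ≡ suc b × b ≡ suc c)
≈₁-distinct-monotone ab bc a≢b b≢c a≢c with ≈₁-≢ ab a≢b | ≈₁-≢ bc b≢c
... | inj₂ b≡1+a | inj₂ c≡1+b = inj₁ (b≡1+a , c≡1+b)
... | inj₁ a≡1+b | inj₁ b≡1+c = inj₂ (a≡1+b , b≡1+c)
... | inj₂ b≡1+a | inj₁ b≡1+c = ⊥-elim (a≢c (suc-injective (trans (sym b≡1+a) b≡1+c)))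
... | inj₁ a≡1+b | inj₂ c≡1+b = ⊥-elim (a≢c (trans a≡1+b (sym c≡1+b)))

squeeze : ∀ {x a} → suc a ≤ x → x ≤ suc (suc a) → x ≢ suc a → x ≢ suc (suc a) → ⊥
squeeze lo hi ≢1 ≢2 = <-irrefl refl (<-≤-trans lo (s≤s⁻¹ (≤∧≢⇒< (s≤s⁻¹ (≤∧≢⇒< hi ≢2)) ≢1)))

-- Distances from a second landmark to p₁ p₂ p₃, q₁ q₂ q₃, s₀ s₂, r₁ r₂ (around a first landmark s₁)
-- that are compatible with the edges between these vertices and separate the pairs s₁ cannot.
s-pair-distances-impossible :
  ∀ {π₁ π₂ π₃ κ₁ κ₂ κ₃ σ₀ σ₂ ρ₁ ρ₂} →
  (π₂ ≡ suc π₁ × π₃ ≡ suc π₂) ⊎ (π₁ ≡ suc π₂ × π₂ ≡ suc π₃) →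
  κ₁ ≡ suc π₁ → κ₁ < σ₀ → κ₃ ≡ suc π₃ → κ₃ < σ₂ →
  σ₂ ≤ suc ρ₂ → ρ₂ ≤ suc κ₂ → κ₂ ≤ suc π₂ → ρ₁ ≤ suc κ₁ → σ₀ ≤ suc ρ₁ → ρ₁ ≤ suc κ₂ → ρ₂ ≤ suc κ₃ →
  σ₀ ≢ κ₂ → σ₀ ≢ κ₃ → σ₂ ≢ κ₂ → σ₂ ≢ κ₁ → ⊥
s-pair-distances-impossible {π₁} {κ₂ = κ₂} (inj₁ (refl , refl)) refl κ₁<σ₀ refl κ₃<σ₂ σ₂r ρ₂κ κ₂π ρ₁κ σ₀ρ _ _ σ₀≢κ₂ σ₀≢κ₃ _ _ =
  squeeze κ₁<σ₀ (≤-trans σ₀ρ (s≤s ρ₁κ)) (λ eq → σ₀≢κ₂ (trans eq (sym κ₂≡))) σ₀≢κ₃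
  where
  κ₂≡ : κ₂ ≡ suc (suc π₁)
  κ₂≡ = ≤-antisym κ₂π (s≤s⁻¹ (≤-trans (s≤s⁻¹ (≤-trans κ₃<σ₂ σ₂r)) ρ₂κ))
s-pair-distances-impossible {π₃ = π₃} {κ₂ = κ₂} (inj₂ (refl , refl)) refl κ₁<σ₀ refl κ₃<σ₂ σ₂r _ κ₂π _ σ₀ρ ρ₁κ₂ ρ₂κ₃ _ _ σ₂≢κ₂ σ₂≢κ₁ =
  squeeze κ₃<σ₂ (≤-trans σ₂r (s≤s ρ₂κ₃)) (λ eq → σ₂≢κ₂ (trans eq (sym κ₂≡))) σ₂≢κ₁
  where
  κ₂≡ : κ₂ ≡ suc (suc π₃)
  κ₂≡ = ≤-antisym κ₂π (s≤s⁻¹ (≤-trans (s≤s⁻¹ (≤-trans κ₁<σ₀ σ₀ρ)) ρ₁κ₂))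

module LowerBound (N : ℕ) (5≤N : 5 ≤ N) where
  open PDistance N

  -- Offsets below 6 ≤ n never wrap around the cycle.
  Offset : Set
  Offset = Fin 6

  vertexAt : Fin n → Kind × Offset → Vertex n
  vertexAt u (k , d) = k , advance (toℕ d) u

  toℕ-offset<n : ∀ (d : Offset) → toℕ d < n
  toℕ-offset<n d = ≤-trans (toℕ<n d) (s≤s 5≤N)

  advance-injective : ∀ u {a b} → a < n → b < n → advance a u ≡ advance b u → a ≡ b
  advance-injective u {a} {b} a<n b<n eq =
    trans (sym (offset-advance a u a<n)) (trans (cong (offset u) eq) (offset-advance b u b<n))

  advance-≢ : ∀ u (a b : Offset) → a ≢ b → advance (toℕ a) u ≢ advance (toℕ b) u
  advance-≢ u a b a≢b = a≢b ∘ toℕ-injective ∘ advance-injective u (toℕ-offset<n a) (toℕ-offset<n b)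

  vertexAt-≢ : ∀ u {k} (a b : Offset) → a ≢ b → vertexAt u (k , a) ≢ vertexAt u (k , b)
  vertexAt-≢ u a b a≢b = advance-≢ u a b a≢b ∘ cong proj₂

  vertexAt-injective : ∀ u {c c′} → vertexAt u c ≡ vertexAt u c′ → c ≡ c′
  vertexAt-injective u {k , d} {k′ , d′} eq =
    cong₂ _,_ (cong proj₁ eq) (toℕ-injective (advance-injective u (toℕ-offset<n d) (toℕ-offset<n d′) (cong proj₂ eq)))

  family-injective : ∀ {D} u (code : Fin D → Kind × Offset) (index : Kind × Offset → Fin D) →
                     (∀ i → index (code i) ≡ i) → ∀ i j → i ≢ j → vertexAt u (code i) ≢ vertexAt u (code j)
  family-injective u code index left i j i≢j eq =
    i≢j (trans (sym (left i)) (trans (cong index (vertexAt-injective u eq)) (left j)))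

  2≤n : 2 ≤ n
  2≤n = s≤s (≤-trans (s≤s z≤n) 5≤N)

  recentre : ∀ a k (t : Fin n) (y₂ : Vertex n) → a ≤ n → Resolving ΔAdj ((k , t) ∷ y₂ ∷ []) →
             Resolving ΔAdj ((k , advance a (advance (n ∸ a) t)) ∷ y₂ ∷ [])
  recentre a k t y₂ a≤n = subst (λ i → Resolving ΔAdj ((k , i) ∷ y₂ ∷ [])) (sym (advance-back a t a≤n))

  ¬Resolving-R : ∀ u (y₂ : Vertex n) → ¬ Resolving ΔAdj ((R , advance 1 u) ∷ y₂ ∷ [])
  ¬Resolving-R u y₂ = ¬Resolving-pair-with-large-sphere 1 (vertexAt u ∘ code)
    (family-injective u code index λ { 0F → refl ; 1F → refl ; 2F → refl ; 3F → refl }) on-sphere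
    where
    code : Fin 4 → Kind × Offset
    code 0F = Q , 1F
    code 1F = Q , 2F
    code 2F = S , 1F
    code 3F = S , 0F
    index : Kind × Offset → Fin 4
    index (Q , 1F) = 0F
    index (Q , 2F) = 1F
    index (S , 1F) = 2F
    index _ = 3F
    on-sphere : ∀ i → Dist ΔAdj (R , advance 1 u) (vertexAt u (code i)) 1
    on-sphere 0F = Dist-1 (inj₂ (qr _)) λ ()
    on-sphere 1F = Dist-1 (inj₁ (rq _)) λ ()
    on-sphere 2F = Dist-1 (inj₁ (rs _)) λ ()
    on-sphere 3F = Dist-1 (inj₂ (sr _)) λ ()

  ¬P-adjacent : ∀ {t : Fin n} {v : Vertex n} → v ≢ (P , next t) → v ≢ (Q , t) →
                (∀ t′ → v ≡ (P , t′) → next t′ ≢ t) → ¬ ΔAdj (P , t) v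
  ¬P-adjacent ≢p _ _ (inj₁ (pp _)) = ≢p refl
  ¬P-adjacent _ ≢q _ (inj₁ (pq _)) = ≢q refl
  ¬P-adjacent _ _ ≢p′ (inj₂ (pp t′)) = ≢p′ t′ refl refl

  ¬Q-adjacent : ∀ {t : Fin n} {v : Vertex n} → v ≢ (P , t) → proj₁ v ≢ R → ¬ ΔAdj (Q , t) v
  ¬Q-adjacent ≢p _ (inj₂ (pq _)) = ≢p refl
  ¬Q-adjacent _ ≢R (inj₁ (qr _)) = ≢R refl
  ¬Q-adjacent _ ≢R (inj₂ (rq _)) = ≢R refl

  ¬Resolving-P : ∀ u (y₂ : Vertex n) → ¬ Resolving ΔAdj ((P , advance 2 u) ∷ y₂ ∷ [])
  ¬Resolving-P u y₂ = ¬Resolving-pair-with-large-sphere 2 (vertexAt u ∘ code)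
    (family-injective u code index λ { 0F → refl ; 1F → refl ; 2F → refl ; 3F → refl ; 4F → refl ; 5F → refl }) on-sphere
    where
    code : Fin 6 → Kind × Offset
    code 0F = P , 0F
    code 1F = P , 4F
    code 2F = Q , 1F
    code 3F = Q , 3F
    code 4F = R , 1F
    code 5F = R , 2F
    index : Kind × Offset → Fin 6
    index (P , 0F) = 0F
    index (P , _) = 1F
    index (Q , 1F) = 2F
    index (Q , _) = 3F
    index (R , 1F) = 4F
    index _ = 5F
    on-sphere : ∀ i → Dist ΔAdj (P , advance 2 u) (vertexAt u (code i)) 2
    on-sphere 0F = Dist-2 (step (inj₂ (pp _)) (step (inj₂ (pp _)) here)) (vertexAt-≢ u 2F 0F λ ())
      (¬P-adjacent (vertexAt-≢ u 0F 3F λ ()) (λ ()) λ t′ eq → advance-≢ u 1F 2F (λ ()) ∘ trans (cong next (cong proj₂ eq)))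
    on-sphere 1F = Dist-2 (step (inj₁ (pp _)) (step (inj₁ (pp _)) here)) (vertexAt-≢ u 2F 4F λ ())
      (¬P-adjacent (vertexAt-≢ u 4F 3F λ ()) (λ ()) λ t′ eq → advance-≢ u 5F 2F (λ ()) ∘ trans (cong next (cong proj₂ eq)))
    on-sphere 2F = Dist-2 (step (inj₂ (pp _)) (step (inj₁ (pq _)) here)) (λ ())
      (¬P-adjacent (λ ()) (vertexAt-≢ u 1F 2F λ ()) λ _ ())
    on-sphere 3F = Dist-2 (step (inj₁ (pp _)) (step (inj₁ (pq _)) here)) (λ ())
      (¬P-adjacent (λ ()) (vertexAt-≢ u 3F 2F λ ()) λ _ ())
    on-sphere 4F = Dist-2 (step (inj₁ (pq _)) (step (inj₂ (rq _)) here)) (λ ()) (¬P-adjacent (λ ()) (λ ()) λ _ ())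
    on-sphere 5F = Dist-2 (step (inj₁ (pq _)) (step (inj₁ (qr _)) here)) (λ ()) (¬P-adjacent (λ ()) (λ ()) λ _ ())

  ¬Resolving-Q : ∀ u (y₂ : Vertex n) → ¬ Resolving ΔAdj ((Q , advance 2 u) ∷ y₂ ∷ [])
  ¬Resolving-Q u y₂ = ¬Resolving-pair-with-large-sphere 2 (vertexAt u ∘ code)
    (family-injective u code index λ { 0F → refl ; 1F → refl ; 2F → refl ; 3F → refl ; 4F → refl ; 5F → refl }) on-sphere
    where
    code : Fin 6 → Kind × Offset
    code 0F = S , 0F
    code 1F = S , 1F
    code 2F = S , 2F
    code 3F = Q , 1F
    code 4F = Q , 3F
    code 5F = P , 3F
    index : Kind × Offset → Fin 6
    index (S , 0F) = 0F
    index (S , 1F) = 1F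
    index (S , _) = 2F
    index (Q , 1F) = 3F
    index (Q , _) = 4F
    index _ = 5F
    on-sphere : ∀ i → Dist ΔAdj (Q , advance 2 u) (vertexAt u (code i)) 2
    on-sphere 0F = Dist-2 (step (inj₂ (rq _)) (step (inj₂ (sr _)) here)) (λ ()) (¬Q-adjacent (λ ()) λ ())
    on-sphere 1F = Dist-2 (step (inj₂ (rq _)) (step (inj₁ (rs _)) here)) (λ ()) (¬Q-adjacent (λ ()) λ ())
    on-sphere 2F = Dist-2 (step (inj₁ (qr _)) (step (inj₁ (rs _)) here)) (λ ()) (¬Q-adjacent (λ ()) λ ())
    on-sphere 3F = Dist-2 (step (inj₂ (rq _)) (step (inj₂ (qr _)) here)) (vertexAt-≢ u 2F 1F λ ())
      (¬Q-adjacent (λ ()) λ ())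
    on-sphere 4F = Dist-2 (step (inj₁ (qr _)) (step (inj₁ (rq _)) here)) (vertexAt-≢ u 2F 3F λ ())
      (¬Q-adjacent (λ ()) λ ())
    on-sphere 5F = Dist-2 (step (inj₂ (pq _)) (step (inj₁ (pp _)) here)) (λ ())
      (¬Q-adjacent (vertexAt-≢ u 3F 2F λ ()) λ ())

  ¬S-adjacent : ∀ {t : Fin n} {v : Vertex n} → proj₁ v ≢ R → ¬ ΔAdj (S , t) v
  ¬S-adjacent ≢R (inj₁ (sr _)) = ≢R refl
  ¬S-adjacent ≢R (inj₂ (rs _)) = ≢R refl

  S-neighbour-¬adjacent-P : ∀ {t t′ : Fin n} {w} → ΔAdj (S , t) w → ¬ ΔAdj w (P , t′)
  S-neighbour-¬adjacent-P (inj₁ (sr _)) = λ { (inj₁ ()) ; (inj₂ ()) }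
  S-neighbour-¬adjacent-P (inj₂ (rs _)) = λ { (inj₁ ()) ; (inj₂ ()) }

  Dist-S-P : ∀ {t t′ : Fin n} → Walk ΔAdj (S , t) (P , t′) 3 → Dist ΔAdj (S , t) (P , t′) 3
  Dist-S-P w = Dist-3 w (λ ()) (¬S-adjacent λ ()) S-neighbour-¬adjacent-P

  Q-neighbour : ∀ {t : Fin n} {w} → ΔAdj w (Q , t) → w ≡ (P , t) ⊎ w ≡ (R , t) ⊎ ∃[ t′ ] (w ≡ (R , t′) × next t′ ≡ t)
  Q-neighbour (inj₁ (pq _)) = inj₁ refl
  Q-neighbour (inj₂ (qr _)) = inj₂ (inj₁ refl)
  Q-neighbour (inj₁ (rq t′)) = inj₂ (inj₂ (t′ , refl , refl))

  S-neighbour : ∀ {t : Fin n} {w} → ΔAdj w (S , t) → w ≡ (R , t) ⊎ w ≡ (R , next t)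
  S-neighbour (inj₁ (rs _)) = inj₁ refl
  S-neighbour (inj₂ (sr _)) = inj₂ refl

  -- Both R-neighbours of s_t are adjacent to q_{t+1}, so q_{t+1} is never farther than s_t.
  Dist-Q≤Dist-S : ∀ {y t dq ds} → y ≢ (S , t) → Dist ΔAdj y (Q , next t) dq → Dist ΔAdj y (S , t) ds → dq ≤ ds
  Dist-Q≤Dist-S {ds = zero} y≢s _ (w , _) = ⊥-elim (y≢s (Walk-0⇒≡ w))
  Dist-Q≤Dist-S {t = t} {ds = suc _} _ (_ , shortest) (w , _) with unsnocʷ w
  ... | _ , w′ , e with S-neighbour e
  ...   | inj₁ refl = shortest _ (snocʷ w′ (inj₁ (rq t)))
  ...   | inj₂ refl = shortest _ (snocʷ w′ (inj₂ (qr (next t))))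

  -- If q_{t+1} is strictly closer than s_t, a shortest walk to q_{t+1} cannot arrive from an R-vertex.
  Dist-Q<Dist-S : ∀ {y t dq ds dp} → y ≢ (Q , next t) → Dist ΔAdj y (Q , next t) dq → Dist ΔAdj y (S , t) ds →
                  Dist ΔAdj y (P , next t) dp → dq < ds → dq ≡ suc dp
  Dist-Q<Dist-S {dq = zero} y≢q (w , _) _ _ _ = ⊥-elim (y≢q (Walk-0⇒≡ w))
  Dist-Q<Dist-S {t = t} {dq = suc _} _ (w , shortest) (_ , shortest-S) dp dq<ds with unsnocʷ w
  ... | _ , w′ , e with Q-neighbour e
  ...   | inj₁ refl = ≤-antisym (Dist-adjacent dp (inj₁ (pq _)) (w , shortest)) (s≤s (proj₂ dp _ w′))
  ...   | inj₂ (inj₁ refl) = ⊥-elim (<⇒≱ dq<ds (shortest-S _ (snocʷ w′ (inj₂ (sr t)))))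
  ...   | inj₂ (inj₂ (t′ , refl , next-t′≡next-t)) with next-injective next-t′≡next-t
  ...     | refl = ⊥-elim (<⇒≱ dq<ds (shortest-S _ (snocʷ w′ (inj₁ (rs t′)))))


  module S-Landmark-Pair (u t₂ : Fin n) (res : Resolving ΔAdj ((S , advance 1 u) ∷ (S , t₂) ∷ [])) where

    at : Kind → Offset → Vertex n
    at k d = vertexAt u (k , d)

    y₁ y₂ : Vertex n
    y₁ = at S 1F
    y₂ = S , t₂

    separation : ∀ {v w e} → v ≢ w → Dist ΔAdj y₁ v e → Dist ΔAdj y₁ w e → Separates y₂ v w
    separation = Resolving-pair-separates res

    differ : ∀ {v w e a b} → v ≢ w → Dist ΔAdj y₁ v e → Dist ΔAdj y₁ w e → Dist ΔAdj y₂ v a → Dist ΔAdj y₂ w b → a ≢ b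
    differ v≢w dv dw = Separates⇒≢ (separation v≢w dv dw)

    y₁-R₁ : Dist ΔAdj y₁ (at R 1F) 1
    y₁-R₁ = Dist-1 (inj₂ (rs _)) λ ()
    y₁-R₂ : Dist ΔAdj y₁ (at R 2F) 1
    y₁-R₂ = Dist-1 (inj₁ (sr _)) λ ()
    y₁-Q₁ : Dist ΔAdj y₁ (at Q 1F) 2
    y₁-Q₁ = Dist-2 (step (inj₂ (rs _)) (step (inj₂ (qr _)) here)) (λ ()) (¬S-adjacent λ ())
    y₁-Q₂ : Dist ΔAdj y₁ (at Q 2F) 2
    y₁-Q₂ = Dist-2 (step (inj₂ (rs _)) (step (inj₁ (rq _)) here)) (λ ()) (¬S-adjacent λ ())
    y₁-Q₃ : Dist ΔAdj y₁ (at Q 3F) 2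
    y₁-Q₃ = Dist-2 (step (inj₁ (sr _)) (step (inj₁ (rq _)) here)) (λ ()) (¬S-adjacent λ ())
    y₁-S₀ : Dist ΔAdj y₁ (at S 0F) 2
    y₁-S₀ = Dist-2 (step (inj₂ (rs _)) (step (inj₂ (sr _)) here)) (vertexAt-≢ u 1F 0F λ ()) (¬S-adjacent λ ())
    y₁-S₂ : Dist ΔAdj y₁ (at S 2F) 2
    y₁-S₂ = Dist-2 (step (inj₁ (sr _)) (step (inj₁ (rs _)) here)) (vertexAt-≢ u 1F 2F λ ()) (¬S-adjacent λ ())
    y₁-P₁ : Dist ΔAdj y₁ (at P 1F) 3
    y₁-P₁ = Dist-S-P (step (inj₂ (rs _)) (step (inj₂ (qr _)) (step (inj₂ (pq _)) here)))
    y₁-P₂ : Dist ΔAdj y₁ (at P 2F) 3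
    y₁-P₂ = Dist-S-P (step (inj₂ (rs _)) (step (inj₁ (rq _)) (step (inj₂ (pq _)) here)))
    y₁-P₃ : Dist ΔAdj y₁ (at P 3F) 3
    y₁-P₃ = Dist-S-P (step (inj₁ (sr _)) (step (inj₁ (rq _)) (step (inj₂ (pq _)) here)))

    -- s₂ is as far from p₂ as from p₃, like s₁.
    ¬at-S₂ : t₂ ≢ advance 2 u
    ¬at-S₂ refl = differ (vertexAt-≢ u 2F 3F λ ()) y₁-P₂ y₁-P₃
      (Dist-S-P (step (inj₂ (rs _)) (step (inj₂ (qr _)) (step (inj₂ (pq _)) here))))
      (Dist-S-P (step (inj₂ (rs _)) (step (inj₁ (rq _)) (step (inj₂ (pq _)) here)))) refl

    -- s₀ is as far from p₁ as from p₂, like s₁.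
    ¬at-S₀ : t₂ ≢ advance 0 u
    ¬at-S₀ refl = differ (vertexAt-≢ u 1F 2F λ ()) y₁-P₁ y₁-P₂
      (Dist-S-P (step (inj₁ (sr _)) (step (inj₂ (qr _)) (step (inj₂ (pq _)) here))))
      (Dist-S-P (step (inj₁ (sr _)) (step (inj₁ (rq _)) (step (inj₂ (pq _)) here)))) refl

    ¬elsewhere : t₂ ≢ advance 2 u → t₂ ≢ advance 0 u → ⊥
    ¬elsewhere t₂≢2 t₂≢0
      with separation (vertexAt-≢ u 1F 2F λ ()) y₁-R₁ y₁-R₂ | separation (λ ()) y₁-Q₁ y₁-S₀
         | separation (λ ()) y₁-Q₃ y₁-S₂ | separation (λ ()) y₁-Q₂ y₁-S₀
         | separation (vertexAt-≢ u 1F 2F λ ()) y₁-P₁ y₁-P₂ | separation (vertexAt-≢ u 3F 1F λ ()) y₁-P₃ y₁-P₁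
    ... | ρ₁ , ρ₂ , dR₁ , dR₂ , _ | κ₁ , σ₀ , dQ₁ , dS₀ , κ₁≢σ₀ | κ₃ , σ₂ , dQ₃ , dS₂ , κ₃≢σ₂ | κ₂ , _ , dQ₂ , _
        | π₁ , π₂ , dP₁ , dP₂ , π₁≢π₂ | π₃ , _ , dP₃ , _ =
      s-pair-distances-impossible
        (≈₁-distinct-monotone (Dist-adjacent dP₂ (inj₂ (pp _)) dP₁ , Dist-adjacent dP₁ (inj₁ (pp _)) dP₂)
                              (Dist-adjacent dP₃ (inj₂ (pp _)) dP₂ , Dist-adjacent dP₂ (inj₁ (pp _)) dP₃)
                              π₁≢π₂ (differ (vertexAt-≢ u 2F 3F λ ()) y₁-P₂ y₁-P₃ dP₂ dP₃)
                              (differ (vertexAt-≢ u 1F 3F λ ()) y₁-P₁ y₁-P₃ dP₁ dP₃))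
        (Dist-Q<Dist-S (λ ()) dQ₁ dS₀ dP₁ κ₁<σ₀) κ₁<σ₀ (Dist-Q<Dist-S (λ ()) dQ₃ dS₂ dP₃ κ₃<σ₂) κ₃<σ₂
        (Dist-adjacent dR₂ (inj₁ (rs _)) dS₂) (Dist-adjacent dQ₂ (inj₁ (qr _)) dR₂)
        (Dist-adjacent dP₂ (inj₁ (pq _)) dQ₂) (Dist-adjacent dQ₁ (inj₁ (qr _)) dR₁)
        (Dist-adjacent dR₁ (inj₂ (sr _)) dS₀) (Dist-adjacent dQ₂ (inj₂ (rq _)) dR₁)
        (Dist-adjacent dQ₃ (inj₂ (rq _)) dR₂)
        (differ (λ ()) y₁-S₀ y₁-Q₂ dS₀ dQ₂) (differ (λ ()) y₁-S₀ y₁-Q₃ dS₀ dQ₃)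
        (differ (λ ()) y₁-S₂ y₁-Q₂ dS₂ dQ₂) (differ (λ ()) y₁-S₂ y₁-Q₁ dS₂ dQ₁)
      where
      κ₁<σ₀ : κ₁ < σ₀
      κ₁<σ₀ = ≤∧≢⇒< (Dist-Q≤Dist-S (t₂≢0 ∘ cong proj₂) dQ₁ dS₀) κ₁≢σ₀
      κ₃<σ₂ : κ₃ < σ₂
      κ₃<σ₂ = ≤∧≢⇒< (Dist-Q≤Dist-S (t₂≢2 ∘ cong proj₂) dQ₃ dS₂) κ₃≢σ₂

  ¬Resolving-S-S : ∀ u t₂ → ¬ Resolving ΔAdj ((S , advance 1 u) ∷ (S , t₂) ∷ [])
  ¬Resolving-S-S u t₂ res with t₂ ≟ᶠ advance 2 u | t₂ ≟ᶠ advance 0 u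
  ... | yes t₂≡2 | _ = S-Landmark-Pair.¬at-S₂ u t₂ res t₂≡2
  ... | no _ | yes t₂≡0 = S-Landmark-Pair.¬at-S₀ u t₂ res t₂≡0
  ... | no t₂≢2 | no t₂≢0 = S-Landmark-Pair.¬elsewhere u t₂ res t₂≢2 t₂≢0

  ¬Resolving-non-S : ∀ k (t : Fin n) (y₂ : Vertex n) → k ≢ S → ¬ Resolving ΔAdj ((k , t) ∷ y₂ ∷ [])
  ¬Resolving-non-S P t y₂ _ = ¬Resolving-P (advance (n ∸ 2) t) y₂ ∘ recentre 2 P t y₂ 2≤n
  ¬Resolving-non-S Q t y₂ _ = ¬Resolving-Q (advance (n ∸ 2) t) y₂ ∘ recentre 2 Q t y₂ 2≤n
  ¬Resolving-non-S R t y₂ _ = ¬Resolving-R (advance (n ∸ 1) t) y₂ ∘ recentre 1 R t y₂ (s≤s z≤n)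
  ¬Resolving-non-S S t y₂ S≢S = ⊥-elim (S≢S refl)

  ¬Resolving-pair : ∀ (y₁ y₂ : Vertex n) → ¬ Resolving ΔAdj (y₁ ∷ y₂ ∷ [])
  ¬Resolving-pair (S , t₁) (S , t₂) = ¬Resolving-S-S (advance (n ∸ 1) t₁) t₂ ∘ recentre 1 S t₁ (S , t₂) (s≤s z≤n)
  ¬Resolving-pair (S , t₁) (P , t₂) = ¬Resolving-non-S P t₂ (S , t₁) (λ ()) ∘ Resolving-swap
  ¬Resolving-pair (S , t₁) (Q , t₂) = ¬Resolving-non-S Q t₂ (S , t₁) (λ ()) ∘ Resolving-swap
  ¬Resolving-pair (S , t₁) (R , t₂) = ¬Resolving-non-S R t₂ (S , t₁) (λ ()) ∘ Resolving-swap
  ¬Resolving-pair (P , t₁) y₂ = ¬Resolving-non-S P t₁ y₂ λ ()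
  ¬Resolving-pair (Q , t₁) y₂ = ¬Resolving-non-S Q t₁ y₂ λ ()
  ¬Resolving-pair (R , t₁) y₂ = ¬Resolving-non-S R t₁ y₂ λ ()

  Resolving⇒3≤length : ∀ (Y : List (Vertex n)) → Resolving ΔAdj Y → 3 ≤ length Y
  Resolving⇒3≤length [] res with res (P , fzero) (Q , fzero) (λ ())
  ... | _ , () , _
  Resolving⇒3≤length (y ∷ []) res =
    ⊥-elim (¬Resolving-pair y y (Resolving-mono (λ { (here refl) → here refl ; (there ()) }) res))
  Resolving⇒3≤length (y₁ ∷ y₂ ∷ []) res = ⊥-elim (¬Resolving-pair y₁ y₂ res)
  Resolving⇒3≤length (_ ∷ _ ∷ _ ∷ _) _ = s≤s (s≤s (s≤s z≤n))

n≡n/2+n/2+n%2 : ∀ n → n ≡ n / 2 + n / 2 + n % 2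
n≡n/2+n/2+n%2 n = trans (m≡m%n+[m/n]*n n 2) (regroup (n % 2) (n / 2))
  where
  regroup : ∀ r q → r + q * 2 ≡ q + q + r
  regroup r q = solve (r ∷ q ∷ [])

theorem5 : (n : ℕ) → 6 ≤ n → MetricDim (ΔAdj {n}) 3
theorem5 (suc N) (s≤s 5≤N) =
  (landmarks , landmarks-unique , landmarks-resolving , refl) , λ Y _ → Resolving⇒3≤length Y
  where
  open Landmarks N (suc N / 2) (suc N % 2) (n≡n/2+n/2+n%2 (suc N)) (s≤s⁻¹ (m%n<n (suc N) 2)) (/-monoˡ-≤ 2 (s≤s 5≤N))
  open LowerBound N 5≤N
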